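{- Let $d\geqslant 4$ and let $F$ be a binary form of degree $d$ with rational coefficients and nonzero discriminant. Suppose that $\mathrm{Aut }({\mathcal Z}(F), \mathbb C) = \{\mathrm{Id}\}$. Then we have \[ \mathrm{Aut}(F, \mathbb Q) = \begin{cases} \left\{ \mathrm{Id}\right\} &\text{ if } 2 \nmid d, \\ \left\{ \pm \mathrm{Id}\right\} &\text{ if } 2 \mid d. \end{cases} \]
   Context: $\mathrm{Aut}(F,\mathbb Q)=\{\gamma\in\mathrm{GL}(2,\mathbb Q):F\circ\gamma=F\}$ with $(F\circ\gamma)(X,Y)=F(u_1X+u_2Y,u_3X+u_4Y)$ for $\gamma$ with rows $(u_1,u_2),(u_3,u_4)$. $\mathcal Z(F)\subset\mathbb P^1(\mathbb C)$ is the set of zeroes of $F$, and $\mathrm{Aut}(\mathcal Z(F),\mathbb C)$ is the set of bijections of $\mathcal Z(F)$ which are restrictions of homographies $\tilde\gamma(x:t)=(u_1x+u_2t:u_3x+u_4t)$ with $\gamma\in\mathrm{GL}(2,\mathbb C)$. -}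

module Defs where

open import Level using (Level; _⊔_)
open import Data.Nat as ℕ using (ℕ; zero; suc; _∸_; _<ᵇ_; _≤ᵇ_)
import Data.Nat.Properties as ℕP
open import Data.Bool using (if_then_else_; _∧_)
open import Data.Fin using (Fin; zero; suc; punchIn)
open import Data.Vec using (Vec; []; _∷_)
import Data.Vec as Vec
open import Data.Product using (Σ; _×_; _,_; ∃)
open import Relation.Nullary using (¬_)
open import Relation.Binary.PropositionalEquality using (_≡_)
open import Algebra.Bundles using (CommutativeRing)
open import Data.Rational as ℚ using (ℚ)
open import Data.Integer using (+_)
import Data.Rational.Properties as ℚP

module RingOps {c ℓ} (R : CommutativeRing c ℓ) where
  open CommutativeRing R using (Carrier; _+_; _*_; -_; _-_; 0#; 1#)

  pow : Carrier → ℕ → Carrier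
  pow x zero    = 1#
  pow x (suc n) = x * pow x n

  ∑ : (n : ℕ) → (Fin n → Carrier) → Carrier
  ∑ zero    f = 0#
  ∑ (suc n) f = f zero + ∑ n (λ i → f (suc i))

  ∑≤ : ℕ → (ℕ → Carrier) → Carrier
  ∑≤ zero    f = f zero
  ∑≤ (suc n) f = f zero + ∑≤ n (λ i → f (suc i))

  sgn : ℕ → Carrier
  sgn zero    = 1#
  sgn (suc n) = - sgn n

  det : (n : ℕ) → (Fin n → Fin n → Carrier) → Carrier
  det zero    M = 1#
  det (suc n) M =
    ∑ (suc n) (λ j → sgn (Data.Fin.toℕ j) * (M zero j *
      det n (λ i k → M (suc i) (punchIn j k))))

  evalForm : (d : ℕ) → Vec Carrier (suc d) → Carrier → Carrier → Carrier
  evalForm d a X Y =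
    ∑ (suc d) (λ i → Vec.lookup a i * (pow X (d ∸ Data.Fin.toℕ i) * pow Y (Data.Fin.toℕ i)))

  -- 2×2 matrices (rows (u1,u2),(u3,u4))
  record Mat2 : Set c where
    constructor mat
    field u1 u2 u3 u4 : Carrier

  det2 : Mat2 → Carrier
  det2 (mat u1 u2 u3 u4) = u1 * u4 - u2 * u3

  compose : (d : ℕ) → Vec Carrier (suc d) → Mat2 → Carrier → Carrier → Carrier
  compose d a (mat u1 u2 u3 u4) X Y = evalForm d a (u1 * X + u2 * Y) (u3 * X + u4 * Y)

module Q = RingOps ℚP.+-*-commutativeRing

open Q public using () renaming (Mat2 to Mat2ℚ; mat to matℚ; det2 to det2ℚ)

-- Aut(F, ℚ) membership: γ ∈ GL(2, ℚ) and F ∘ γ = F (as functions on ℚ²,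
-- which for ℚ infinite is the same as equality of forms)
InAutℚ : (d : ℕ) → Vec ℚ (suc d) → Mat2ℚ → Set
InAutℚ d F γ =
  ¬ (det2ℚ γ ≡ ℚ.0ℚ) × (∀ X Y → Q.compose d F γ X Y ≡ Q.evalForm d F X Y)

Idℚ : Mat2ℚ
Idℚ = matℚ ℚ.1ℚ ℚ.0ℚ ℚ.0ℚ ℚ.1ℚ

-Idℚ : Mat2ℚ
-Idℚ = matℚ (ℚ.- ℚ.1ℚ) ℚ.0ℚ ℚ.0ℚ (ℚ.- ℚ.1ℚ)

ℕ→ℚ : ℕ → ℚ
ℕ→ℚ k = (+ k) ℚ./ 1

coef : ∀ {n} → Vec ℚ n → ℕ → ℚ
coef []      _       = ℚ.0ℚ
coef (x ∷ a) zero    = x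
coef (x ∷ a) (suc i) = coef a i

sylvester : (m : ℕ) → (ℕ → ℚ) → (ℕ → ℚ) → ℕ → ℕ → ℚ
sylvester m p q r col =
  if r <ᵇ m
    then (if (r ≤ᵇ col) ∧ (col ≤ᵇ r ℕ.+ m) then p (col ∸ r) else ℚ.0ℚ)
    else (if ((r ∸ m) ≤ᵇ col) ∧ (col ≤ᵇ (r ∸ m) ℕ.+ m) then q (col ∸ (r ∸ m)) else ℚ.0ℚ)

resultant : (m : ℕ) → (ℕ → ℚ) → (ℕ → ℚ) → ℚ
resultant m p q =
  Q.det (m ℕ.+ m) (λ r col → sylvester m p q (Data.Fin.toℕ r) (Data.Fin.toℕ col))

-- Partial derivatives of F = ∑ a_i X^{d-i} Y^i (forms of degree d-1):
--   ∂F/∂X = ∑_{j} (d-j) a_j X^{d-1-j} Y^j,   ∂F/∂Y = ∑_j (j+1) a_{j+1} X^{d-1-j} Y^j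
∂X-coef : (d : ℕ) → Vec ℚ (suc d) → ℕ → ℚ
∂X-coef d F j = ℕ→ℚ (d ∸ j) ℚ.* coef F j

∂Y-coef : (d : ℕ) → Vec ℚ (suc d) → ℕ → ℚ
∂Y-coef d F j = ℕ→ℚ (suc j) ℚ.* coef F (suc j)

-- Discriminant of a binary form of degree d ≥ 1, via the classical identity
--   d^{d-2} · Disc(F) = (-1)^{d(d-1)/2} · Res(∂F/∂X, ∂F/∂Y).
-- (For d = 0 we set it to 0; only d ≥ 4 is used.)
disc : (d : ℕ) → Vec ℚ (suc d) → ℚ
disc zero    F = ℚ.0ℚ
disc (suc n) F =
  Q.sgn ((suc n ℕ.* n) ℕ./ 2)
    ℚ.* (resultant n (∂X-coef (suc n) F) (∂Y-coef (suc n) F)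
    ℚ.* ((+ 1) ℚ./ (suc n ℕ.^ (n ∸ 1))))
  where instance _ = ℕP.m^n≢0 (suc n) (n ∸ 1)

-- An algebraically closed field K containing ℚ (stand-in for ℂ)

record ClosedFieldOverℚ (c ℓ : Level) : Set (Level.suc (c ⊔ ℓ)) where
  field
    K-ring : CommutativeRing c ℓ
  open CommutativeRing K-ring public using (Carrier; _≈_; _+_; _*_; -_; _-_; 0#; 1#)
  open RingOps K-ring public
  field
    0≉1     : ¬ (0# ≈ 1#)
    inverse : ∀ x → ¬ (x ≈ 0#) → ∃ λ y → x * y ≈ 1#
    ι       : ℚ → Carrier
    ι-0     : ι ℚ.0ℚ ≈ 0#
    ι-1     : ι ℚ.1ℚ ≈ 1#
    ι-+     : ∀ a b → ι (a ℚ.+ b) ≈ ι a + ι b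
    ι-*     : ∀ a b → ι (a ℚ.* b) ≈ ι a * ι b
    closed  : ∀ n (a : Fin (suc n) → Carrier) →
              ∃ λ x → pow x (suc n) + ∑ (suc n) (λ i → a i * pow x (Data.Fin.toℕ i)) ≈ 0#

module Zeros {c ℓ} (K : ClosedFieldOverℚ c ℓ) (d : ℕ) (F : Vec ℚ (suc d)) where
  open ClosedFieldOverℚ K

  -- (x, t) represents a point (x : t) of ℙ¹(K)
  NonZeroPt : Carrier → Carrier → Set ℓ
  NonZeroPt x t = ¬ ((x ≈ 0#) × (t ≈ 0#))

  _∼_ : Carrier × Carrier → Carrier × Carrier → Set ℓ
  (x , t) ∼ (x′ , t′) = x * t′ ≈ x′ * t

  InZ : Carrier × Carrier → Set ℓ
  InZ (x , t) = NonZeroPt x t × (evalForm d (Vec.map ι F) x t ≈ 0#)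

  hom : Mat2 → Carrier × Carrier → Carrier × Carrier
  hom (mat u1 u2 u3 u4) (x , t) = (u1 * x + u2 * t , u3 * x + u4 * t)

  -- γ̃ restricts to a bijection of 𝒵(F) (injectivity is automatic)
  PermutesZ : Mat2 → Set (c ⊔ ℓ)
  PermutesZ γ =
    (∀ p → InZ p → InZ (hom γ p)) ×
    (∀ q → InZ q → ∃ λ p → InZ p × (hom γ p ∼ q))

  AutZTrivial : Set (c ⊔ ℓ)
  AutZTrivial =
    ∀ (γ : Mat2) → ¬ (det2 γ ≈ 0#) → PermutesZ γ → ∀ p → InZ p → hom γ p ∼ p

-- Let γ ∈ Aut(F, ℚ). Since F ∘ γ and F agree at infinitely many rational points, they have the
-- same coefficients, so γ̃ preserves F over the algebraically closed field too and therefore permutes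
-- 𝒵(F); by hypothesis it then fixes every zero (1 : r) of F, i.e. u₂r² + (u₁ - u₄)r - u₃ = 0.
-- A nonzero discriminant means that F(1, t) has no double root and degree at least d - 1 ≥ 3, hence
-- three distinct roots, so this quadratic vanishes and γ = λ·Id. Then λᵈ = 1 because F ≠ 0, so
-- λ = ±1 over ℚ, and -Id preserves F exactly when d is even. Both facts about the discriminant are
-- read off the Sylvester matrix of ∂F/∂X and ∂F/∂Y: a common zero (1 : r) puts (1, r, r², …) in
-- its kernel, and vanishing top coefficients make its last column zero.

{-# OPTIONS --safe #-}
module Submission where

open import Level using (Level; _⊔_)
open import Algebra.Bundles using (CommutativeRing)
open import Algebra.Solver.Ring.AlmostCommutativeRing using (_-Raw-AlmostCommutative⟶_; fromCommutativeRing)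
import Algebra.Solver.Ring as RingSolver
open import Data.Maybe using (Maybe; just; nothing)
open import Data.Nat as ℕ using (ℕ; zero; suc; _∸_; s≤s; z≤n)
import Data.Nat.Properties as ℕP
open import Data.Fin as Fin using (Fin; zero; suc; toℕ; punchIn; punchOut; inject₁)
import Data.Fin.Properties as FinP
open import Data.Vec as Vec using (Vec; []; _∷_)
import Data.Vec.Properties as VecP
open import Data.Rational as ℚ using (ℚ; 0ℚ; 1ℚ)
import Data.Rational.Properties as ℚP
open import Data.Empty using (⊥; ⊥-elim)
open import Data.Sum as Sum using (_⊎_; inj₁; inj₂)
open import Data.Product using (_,_; _×_; proj₁; proj₂; Σ; ∃)
open import Relation.Nullary.Decidable using (decidable-stable; _×-dec_)
open import Relation.Nullary.Negation using (¬¬-map)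
open import Relation.Nullary using (¬_; Dec; yes; no; ¬¬-excluded-middle)
open import Data.Nat.Divisibility using (_∣_; divides; _∣0; ∣1⇒≡1; ∣m+n∣m⇒∣n)
open import Relation.Binary.Definitions using (tri<; tri≈; tri>)
open import Data.Bool using (true; false; T; if_then_else_; _∧_)
open import Data.Unit using (tt)
open import Relation.Binary.PropositionalEquality as P using (_≡_; _≢_)
open import Function using (_∘_)
open import Function.Bundles using (_⇔_; mk⇔)
open import Data.Integer as ℤ using (+_)
import Data.Integer.Properties as ℤP
import Data.Nat.Coprimality as Coprimality
open import Defs

ℕ→ℚ≡mkℚ : ∀ k → ℕ→ℚ k ≡ ℚ.mkℚ (+ k) 0 (Coprimality.sym (Coprimality.1-coprimeTo k))
ℕ→ℚ≡mkℚ k = ℚP.↥p/↧p≡p (ℚ.mkℚ (+ k) 0 (Coprimality.sym (Coprimality.1-coprimeTo k)))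

ℕ→ℚ-suc : ∀ k → ℕ→ℚ (suc k) ≡ 1ℚ ℚ.+ ℕ→ℚ k
ℕ→ℚ-suc k = P.sym (P.trans (P.cong (1ℚ ℚ.+_) (ℕ→ℚ≡mkℚ k))
                            (P.cong (ℚ._/ 1) (P.cong (ℤ._+_ (+ 1)) (ℤP.*-identityʳ (+ k)))))

open import Algebra.Properties.Group ℚP.+-0-group using () renaming (x∙y⁻¹≈ε⇒x≈y to p-q≡0⇒p≡q; ⁻¹-involutive to neg-involutive)

ℕ→ℚ-injective : ∀ {j k} → ℕ→ℚ j ≡ ℕ→ℚ k → j ≡ k
ℕ→ℚ-injective {j} {k} e = ℤP.+-injective (P.cong ℚ.↥_ (P.trans (P.sym (ℕ→ℚ≡mkℚ j)) (P.trans e (ℕ→ℚ≡mkℚ k))))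

-- The map from ℚ gives the ring solver coefficients with decidable equality, and makes the
-- differences of distinct natural numbers invertible (used by the identity theorem below).
record Commutativeℚ-Algebra (c ℓ : Level) : Set (Level.suc (c ⊔ ℓ)) where
  field
    commutativeRing : CommutativeRing c ℓ
  open CommutativeRing commutativeRing using (Carrier; _≈_; _+_; _*_; 0#; 1#)
  field
    ι   : ℚ → Carrier
    ι-0 : ι 0ℚ ≈ 0#
    ι-1 : ι 1ℚ ≈ 1#
    ι-+ : ∀ a b → ι (a ℚ.+ b) ≈ ι a + ι b
    ι-* : ∀ a b → ι (a ℚ.* b) ≈ ι a * ι b

ℚ-algebra : Commutativeℚ-Algebra _ _
ℚ-algebra = record
  { commutativeRing = ℚP.+-*-commutativeRing
  ; ι = λ a → a ; ι-0 = P.refl ; ι-1 = P.refl ; ι-+ = λ _ _ → P.refl ; ι-* = λ _ _ → P.refl }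

module Properties {c ℓ} (A : Commutativeℚ-Algebra c ℓ) where
  open Commutativeℚ-Algebra A public
  open CommutativeRing commutativeRing public hiding (zero)
  open RingOps commutativeRing public
  open import Relation.Binary.Reasoning.Setoid setoid public

  open import Algebra.Properties.Group +-group public
    using () renaming (x∙y⁻¹≈ε⇒x≈y to x-y≈0⇒x≈y; x≈y⇒x∙y⁻¹≈ε to x≈y⇒x-y≈0; inverseˡ-unique to x+y≈0⇒x≈-y)

  ι-neg : ∀ a → ι (ℚ.- a) ≈ - ι a
  ι-neg a = x+y≈0⇒x≈-y (ι (ℚ.- a)) (ι a) (trans (sym (ι-+ (ℚ.- a) a)) (trans (reflexive (P.cong ι (ℚP.+-inverseˡ a))) ι-0))

  private
    ι-morphism : CommutativeRing.rawRing ℚP.+-*-commutativeRing -Raw-AlmostCommutative⟶ fromCommutativeRing commutativeRing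
    ι-morphism = record
      { ⟦_⟧ = ι ; +-homo = ι-+ ; *-homo = ι-* ; -‿homo = ι-neg ; 0-homo = ι-0 ; 1-homo = ι-1 }

    ι-equal? : ∀ a b → Maybe (ι a ≈ ι b)
    ι-equal? a b with a ℚP.≟ b
    ... | yes P.refl = just refl
    ... | no _       = nothing

  open RingSolver (CommutativeRing.rawRing ℚP.+-*-commutativeRing) (fromCommutativeRing commutativeRing) ι-morphism ι-equal? public
    using (solve; _:=_; _:+_; _:*_; :-_; _:-_; con)

  fromℕ : ℕ → Carrier
  fromℕ zero    = 0#
  fromℕ (suc k) = 1# + fromℕ k

  fromℕ-suc-* : ∀ k x → fromℕ (suc k) * x ≈ x + fromℕ k * x
  fromℕ-suc-* k x = trans (distribʳ x 1# (fromℕ k)) (+-congʳ (*-identityˡ x))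

  ι-cancelˡ : ∀ {q x} → q ≢ 0ℚ → ι q * x ≈ 0# → x ≈ 0#
  ι-cancelˡ {q} {x} q≢0 qx≈0 = begin
    x                      ≈⟨ sym (*-identityˡ x) ⟩
    1# * x                 ≈⟨ *-congʳ (sym (trans (sym (ι-* _ _)) (trans (reflexive (P.cong ι (ℚP.*-inverseˡ q))) ι-1))) ⟩
    ι (ℚ.1/ q) * ι q * x   ≈⟨ *-assoc _ _ _ ⟩
    ι (ℚ.1/ q) * (ι q * x) ≈⟨ *-congˡ qx≈0 ⟩
    ι (ℚ.1/ q) * 0#        ≈⟨ zeroʳ _ ⟩
    0#                     ∎
    where instance _ = ℚ.≢-nonZero q≢0

  ι-injective : ¬ (0# ≈ 1#) → ∀ {a b} → ι a ≈ ι b → a ≡ b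
  ι-injective 0≉1 {a} {b} ιa≈ιb with a ℚ.- b ℚP.≟ 0ℚ
  ... | yes a-b≡0 = p-q≡0⇒p≡q a b a-b≡0
  ... | no a-b≢0  = ⊥-elim (0≉1 (sym (ι-cancelˡ a-b≢0 ι[a-b]*1≈0)))
    where
    ι[a-b]*1≈0 : ι (a ℚ.- b) * 1# ≈ 0#
    ι[a-b]*1≈0 = trans (*-identityʳ _) (trans (ι-+ a (ℚ.- b)) (trans (+-congˡ (ι-neg b)) (x≈y⇒x-y≈0 ιa≈ιb)))

  ι-ℕ→ℚ : ∀ k → ι (ℕ→ℚ k) ≈ fromℕ k
  ι-ℕ→ℚ zero    = ι-0
  ι-ℕ→ℚ (suc k) = trans (reflexive (P.cong ι (ℕ→ℚ-suc k))) (trans (ι-+ _ _) (+-cong ι-1 (ι-ℕ→ℚ k)))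

  fromℕ-sub-cancelˡ : ∀ {j k x} → j ≢ k → (fromℕ j - fromℕ k) * x ≈ 0# → x ≈ 0#
  fromℕ-sub-cancelˡ {j} {k} j≢k h = ι-cancelˡ (λ e → j≢k (ℕ→ℚ-injective (p-q≡0⇒p≡q _ _ e)))
    (trans (*-congʳ (trans (ι-+ _ _) (+-cong (ι-ℕ→ℚ j) (trans (ι-neg _) (-‿cong (ι-ℕ→ℚ k)))))) h)

  ∑-cong : ∀ n {f g : Fin n → Carrier} → (∀ i → f i ≈ g i) → ∑ n f ≈ ∑ n g
  ∑-cong zero    h = refl
  ∑-cong (suc n) h = +-cong (h zero) (∑-cong n (λ i → h (suc i)))

  ∑-zero : ∀ n (f : Fin n → Carrier) → (∀ i → f i ≈ 0#) → ∑ n f ≈ 0#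
  ∑-zero zero    f h = refl
  ∑-zero (suc n) f h = trans (+-cong (h zero) (∑-zero n _ (λ i → h (suc i)))) (+-identityʳ 0#)

  ∑-distrib-+ : ∀ n (f g : Fin n → Carrier) → ∑ n (λ i → f i + g i) ≈ ∑ n f + ∑ n g
  ∑-distrib-+ zero    f g = sym (+-identityʳ 0#)
  ∑-distrib-+ (suc n) f g = trans (+-congˡ (∑-distrib-+ n _ _))
    (solve 4 (λ a b c d → (a :+ b) :+ (c :+ d) := (a :+ c) :+ (b :+ d)) refl
      (f zero) (g zero) (∑ n (λ i → f (suc i))) (∑ n (λ i → g (suc i))))

  ∑-distribˡ-* : ∀ n a (f : Fin n → Carrier) → ∑ n (λ i → a * f i) ≈ a * ∑ n f
  ∑-distribˡ-* zero    a f = sym (zeroʳ a)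
  ∑-distribˡ-* (suc n) a f = trans (+-congˡ (∑-distribˡ-* n a _)) (sym (distribˡ a _ _))

  ι-∑ : ∀ n (f : Fin n → ℚ) → ι (Q.∑ n f) ≈ ∑ n (λ i → ι (f i))
  ι-∑ zero    f = ι-0
  ι-∑ (suc n) f = trans (ι-+ _ _) (+-congˡ (ι-∑ n (λ i → f (suc i))))

  pow-cong : ∀ {x y} n → x ≈ y → pow x n ≈ pow y n
  pow-cong zero    e = refl
  pow-cong (suc n) e = *-cong e (pow-cong n e)

  pow-distrib-* : ∀ x y n → pow (x * y) n ≈ pow x n * pow y n
  pow-distrib-* x y zero    = sym (*-identityʳ 1#)
  pow-distrib-* x y (suc n) = trans (*-congˡ (pow-distrib-* x y n))
    (solve 4 (λ x y a b → x :* y :* (a :* b) := x :* a :* (y :* b)) refl x y (pow x n) (pow y n))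

  pow-1 : ∀ n → pow 1# n ≈ 1#
  pow-1 zero    = refl
  pow-1 (suc n) = trans (*-identityˡ _) (pow-1 n)

  ι-pow : ∀ x n → ι (Q.pow x n) ≈ pow (ι x) n
  ι-pow x zero    = ι-1
  ι-pow x (suc n) = trans (ι-* _ _) (*-congˡ (ι-pow x n))

  ι-sgn : ∀ n → ι (Q.sgn n) ≈ sgn n
  ι-sgn zero    = ι-1
  ι-sgn (suc n) = trans (ι-neg _) (-‿cong (ι-sgn n))

module Polynomials {c ℓ} (A : Commutativeℚ-Algebra c ℓ) where
  open Properties A

  -- The length n is not a degree: only p 0, …, p (n - 1) are used.
  evalPoly : ℕ → (ℕ → Carrier) → Carrier → Carrier
  evalPoly zero    p t = 0#
  evalPoly (suc n) p t = p 0 + t * evalPoly n (λ i → p (suc i)) t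

  evalPoly-cong : ∀ n {p q : ℕ → Carrier} {t u} → (∀ i → p i ≈ q i) → t ≈ u → evalPoly n p t ≈ evalPoly n q u
  evalPoly-cong zero    p≈q t≈u = refl
  evalPoly-cong (suc n) p≈q t≈u = +-cong (p≈q 0) (*-cong t≈u (evalPoly-cong n (λ i → p≈q (suc i)) t≈u))

  evalPoly-congʳ : ∀ n p {t u} → t ≈ u → evalPoly n p t ≈ evalPoly n p u
  evalPoly-congʳ n p = evalPoly-cong n (λ _ → refl)

  evalPoly-zero : ∀ n p t → (∀ i → i ℕ.< n → p i ≈ 0#) → evalPoly n p t ≈ 0#
  evalPoly-zero zero    p t h = refl
  evalPoly-zero (suc n) p t h =
    trans (+-cong (h 0 (s≤s z≤n)) (*-congˡ (evalPoly-zero n _ t (λ i i<n → h (suc i) (s≤s i<n)))))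
          (trans (+-identityˡ _) (zeroʳ t))

  evalPoly-trim : ∀ n p t → p n ≈ 0# → evalPoly (suc n) p t ≈ evalPoly n p t
  evalPoly-trim zero    p t pn≈0 = trans (+-cong pn≈0 (zeroʳ t)) (+-identityʳ 0#)
  evalPoly-trim (suc n) p t pn≈0 = +-congˡ (*-congˡ (evalPoly-trim n (λ i → p (suc i)) t pn≈0))

  evalPoly-+ : ∀ n p q t → evalPoly n (λ i → p i + q i) t ≈ evalPoly n p t + evalPoly n q t
  evalPoly-+ zero    p q t = sym (+-identityʳ 0#)
  evalPoly-+ (suc n) p q t = trans (+-congˡ (*-congˡ (evalPoly-+ n _ _ t)))
    (solve 5 (λ a b t x y → a :+ b :+ t :* (x :+ y) := a :+ t :* x :+ (b :+ t :* y)) refl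
      (p 0) (q 0) t (evalPoly n (λ i → p (suc i)) t) (evalPoly n (λ i → q (suc i)) t))

  evalPoly-sub : ∀ n p q t → evalPoly n (λ i → p i - q i) t ≈ evalPoly n p t - evalPoly n q t
  evalPoly-sub zero    p q t = sym (-‿inverseʳ 0#)
  evalPoly-sub (suc n) p q t = trans (+-congˡ (*-congˡ (evalPoly-sub n _ _ t)))
    (solve 5 (λ a b t x y → a :- b :+ t :* (x :- y) := a :+ t :* x :- (b :+ t :* y)) refl
      (p 0) (q 0) t (evalPoly n (λ i → p (suc i)) t) (evalPoly n (λ i → q (suc i)) t))

  evalPoly≈∑ : ∀ n p t → evalPoly n p t ≈ ∑ n (λ i → p (toℕ i) * pow t (toℕ i))
  evalPoly≈∑ zero    p t = refl
  evalPoly≈∑ (suc n) p t = +-cong (sym (*-identityʳ _)) (begin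
    t * evalPoly n (λ i → p (suc i)) t
      ≈⟨ *-congˡ (evalPoly≈∑ n _ t) ⟩
    t * ∑ n (λ i → p (suc (toℕ i)) * pow t (toℕ i))
      ≈⟨ sym (∑-distribˡ-* n t _) ⟩
    ∑ n (λ i → t * (p (suc (toℕ i)) * pow t (toℕ i)))
      ≈⟨ ∑-cong n (λ i → solve 3 (λ t a b → t :* (a :* b) := a :* (t :* b)) refl t (p (suc (toℕ i))) (pow t (toℕ i))) ⟩
    ∑ n (λ i → p (suc (toℕ i)) * (t * pow t (toℕ i))) ∎)

  evalPoly-split-last : ∀ n p t → evalPoly (suc n) p t ≈ evalPoly n p t + p n * pow t n
  evalPoly-split-last zero    p t = trans (+-congˡ (zeroʳ t)) (trans (+-identityʳ _) (sym (trans (+-identityˡ _) (*-identityʳ _))))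
  evalPoly-split-last (suc n) p t = trans (+-congˡ (*-congˡ (evalPoly-split-last n (λ i → p (suc i)) t)))
    (solve 5 (λ a t e b q → a :+ t :* (e :+ b :* q) := (a :+ t :* e) :+ b :* (t :* q)) refl
      (p 0) t (evalPoly n (λ i → p (suc i)) t) (p (suc n)) (pow t n))

  -- Synthetic division: quot (suc n) r p is the quotient of p by t - r (evalPoly-factor).
  quot : ℕ → Carrier → (ℕ → Carrier) → ℕ → Carrier
  quot zero    r p _       = 0#
  quot (suc n) r p zero    = evalPoly n (λ i → p (suc i)) r
  quot (suc n) r p (suc i) = quot n r (λ j → p (suc j)) i

  deriv : ℕ → (ℕ → Carrier) → Carrier → Carrier
  deriv zero    p t = 0#
  deriv (suc n) p t = evalPoly n (λ i → p (suc i)) t + t * deriv n (λ i → p (suc i)) t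

  evalPoly-factor : ∀ n p r t → evalPoly (suc n) p t ≈ evalPoly (suc n) p r + (t - r) * evalPoly n (quot (suc n) r p) t
  evalPoly-factor zero p r t =
    trans (trans (+-congˡ (zeroʳ t)) (+-identityʳ _))
          (sym (trans (+-cong (trans (+-congˡ (zeroʳ r)) (+-identityʳ _)) (zeroʳ (t - r))) (+-identityʳ _)))
  evalPoly-factor (suc n) p r t = begin
    p 0 + t * evalPoly (suc n) p⁺ t
      ≈⟨ +-congˡ (*-congˡ (evalPoly-factor n p⁺ r t)) ⟩
    p 0 + t * (evalPoly (suc n) p⁺ r + (t - r) * evalPoly n (quot (suc n) r p⁺) t)
      ≈⟨ solve 5 (λ a t r x y → a :+ t :* (x :+ (t :- r) :* y) := (a :+ r :* x) :+ (t :- r) :* (x :+ t :* y)) refl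
           (p 0) t r (evalPoly (suc n) p⁺ r) (evalPoly n (quot (suc n) r p⁺) t) ⟩
    (p 0 + r * evalPoly (suc n) p⁺ r) + (t - r) * (evalPoly (suc n) p⁺ r + t * evalPoly n (quot (suc n) r p⁺) t) ∎
    where
    p⁺ : ℕ → Carrier
    p⁺ i = p (suc i)

  evalPoly-quot-at-r : ∀ n p r → evalPoly n (quot (suc n) r p) r ≈ deriv (suc n) p r
  evalPoly-quot-at-r zero    p r = sym (trans (+-identityˡ _) (zeroʳ r))
  evalPoly-quot-at-r (suc n) p r = +-congˡ (*-congˡ (evalPoly-quot-at-r n (λ i → p (suc i)) r))

  evalPoly-quot-swap : ∀ n p r s → evalPoly n (quot (suc n) r p) s ≈ evalPoly n (quot (suc n) s p) r
  evalPoly-quot-swap zero    p r s = refl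
  evalPoly-quot-swap (suc n) p r s = begin
    evalPoly (suc n) p⁺ r + s * y
      ≈⟨ solve 4 (λ x r s y → x :+ s :* y := (x :+ (s :- r) :* y) :+ r :* y) refl (evalPoly (suc n) p⁺ r) r s y ⟩
    (evalPoly (suc n) p⁺ r + (s - r) * y) + r * y
      ≈⟨ +-cong (sym (evalPoly-factor n p⁺ r s)) (*-congˡ (evalPoly-quot-swap n p⁺ r s)) ⟩
    evalPoly (suc n) p⁺ s + r * evalPoly n (quot (suc n) s p⁺) r ∎
    where
    p⁺ : ℕ → Carrier
    p⁺ i = p (suc i)
    y : Carrier
    y = evalPoly n (quot (suc n) r p⁺) s

  evalPoly-quot-comm : ∀ n p r s t →
    evalPoly n (quot (suc n) s (quot (suc (suc n)) r p)) t ≈ evalPoly n (quot (suc n) r (quot (suc (suc n)) s p)) t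
  evalPoly-quot-comm zero    p r s t = refl
  evalPoly-quot-comm (suc n) p r s t =
    +-cong (evalPoly-quot-swap (suc n) (λ i → p (suc i)) r s) (*-congˡ (evalPoly-quot-comm n (λ i → p (suc i)) r s t))

  quot-leading : ∀ n r p → quot (suc (suc n)) r p n ≈ p (suc n)
  quot-leading zero    r p = trans (+-congˡ (zeroʳ r)) (+-identityʳ _)
  quot-leading (suc n) r p = quot-leading n r (λ i → p (suc i))

  deriv-trim : ∀ n p t → p n ≈ 0# → deriv (suc n) p t ≈ deriv n p t
  deriv-trim zero    p t pn≈0 = trans (+-identityˡ _) (zeroʳ t)
  deriv-trim (suc n) p t pn≈0 =
    +-cong (evalPoly-trim n (λ i → p (suc i)) t pn≈0) (*-congˡ (deriv-trim n (λ i → p (suc i)) t pn≈0))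

  deriv≈evalPoly : ∀ n p t → deriv (suc n) p t ≈ evalPoly n (λ i → fromℕ (suc i) * p (suc i)) t
  deriv≈evalPoly zero    p t = trans (+-identityˡ _) (zeroʳ t)
  deriv≈evalPoly (suc n) p t = begin
    (p 1 + t * evalPoly n p⁺⁺ t) + t * deriv (suc n) p⁺ t
      ≈⟨ +-congˡ (*-congˡ (deriv≈evalPoly n p⁺ t)) ⟩
    (p 1 + t * evalPoly n p⁺⁺ t) + t * evalPoly n (λ i → fromℕ (suc i) * p⁺⁺ i) t
      ≈⟨ solve 4 (λ a t x y → (a :+ t :* x) :+ t :* y := a :+ t :* (x :+ y)) refl (p 1) t (evalPoly n p⁺⁺ t) _ ⟩
    p 1 + t * (evalPoly n p⁺⁺ t + evalPoly n (λ i → fromℕ (suc i) * p⁺⁺ i) t)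
      ≈⟨ +-cong (sym (trans (*-congʳ (+-identityʳ 1#)) (*-identityˡ _)))
                (*-congˡ (trans (sym (evalPoly-+ n p⁺⁺ _ t)) (evalPoly-cong n (λ i → sym (fromℕ-suc-* (suc i) _)) refl))) ⟩
    (1# + 0#) * p 1 + t * evalPoly n (λ i → fromℕ (suc (suc i)) * p⁺⁺ i) t ∎
    where
    p⁺ p⁺⁺ : ℕ → Carrier
    p⁺ i = p (suc i)
    p⁺⁺ i = p (suc (suc i))

  euler : ∀ d p t → fromℕ d * evalPoly (suc d) p t ≈ evalPoly d (λ i → fromℕ (d ∸ i) * p i) t + t * deriv (suc d) p t
  euler zero    p t = trans (zeroˡ _) (sym (trans (+-identityˡ _) (trans (*-congˡ (trans (+-identityˡ _) (zeroʳ t))) (zeroʳ t))))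
  euler (suc d) p t = begin
    fromℕ (suc d) * (p 0 + t * e)
      ≈⟨ solve 4 (λ f a t e → f :* (a :+ t :* e) := f :* a :+ t :* (f :* e)) refl (fromℕ (suc d)) (p 0) t e ⟩
    fromℕ (suc d) * p 0 + t * (fromℕ (suc d) * e)
      ≈⟨ +-congˡ (*-congˡ (trans (fromℕ-suc-* d e) (+-congˡ (euler d p⁺ t)))) ⟩
    fromℕ (suc d) * p 0 + t * (e + (S + t * D))
      ≈⟨ solve 6 (λ f a t e S D → f :* a :+ t :* (e :+ (S :+ t :* D)) := (f :* a :+ t :* S) :+ t :* (e :+ t :* D)) refl
           (fromℕ (suc d)) (p 0) t e S D ⟩
    (fromℕ (suc d) * p 0 + t * S) + t * (e + t * D) ∎
    where
    p⁺ : ℕ → Carrier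
    p⁺ i = p (suc i)
    e S D : Carrier
    e = evalPoly (suc d) p⁺ t
    S = evalPoly d (λ i → fromℕ (d ∸ i) * p⁺ i) t
    D = deriv (suc d) p⁺ t

  HasDoubleRoot : ℕ → (ℕ → Carrier) → Set (c ⊔ ℓ)
  HasDoubleRoot n p = Σ Carrier λ r → evalPoly n p r ≈ 0# × deriv n p r ≈ 0#

  record ThreeDistinct (P : Carrier → Set ℓ) : Set (c ⊔ ℓ) where
    field
      r₁ r₂ r₃    : Carrier
      P₁          : P r₁
      P₂          : P r₂
      P₃          : P r₃
      r₁≉r₂       : ¬ (r₁ ≈ r₂)
      r₁≉r₃       : ¬ (r₁ ≈ r₃)
      r₂≉r₃       : ¬ (r₂ ≈ r₃)

  ThreeDistinct-map : ∀ {P Q : Carrier → Set ℓ} → (∀ r → P r → Q r) → ThreeDistinct P → ThreeDistinct Q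
  ThreeDistinct-map P⇒Q T = record
    { r₁ = r₁ ; r₂ = r₂ ; r₃ = r₃ ; P₁ = P⇒Q r₁ P₁ ; P₂ = P⇒Q r₂ P₂ ; P₃ = P⇒Q r₃ P₃
    ; r₁≉r₂ = r₁≉r₂ ; r₁≉r₃ = r₁≉r₃ ; r₂≉r₃ = r₂≉r₃ }
    where open ThreeDistinct T

  root-via-quot : ∀ n p r s → evalPoly (suc n) p r ≈ 0# → evalPoly n (quot (suc n) r p) s ≈ 0# → evalPoly (suc n) p s ≈ 0#
  root-via-quot n p r s p[r]≈0 q[s]≈0 =
    trans (evalPoly-factor n p r s) (trans (+-cong p[r]≈0 (trans (*-congˡ q[s]≈0) (zeroʳ _))) (+-identityʳ 0#))

  factor-at-roots : ∀ n p r s → evalPoly (suc n) p r ≈ 0# → evalPoly (suc n) p s ≈ 0# →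
                    (s - r) * evalPoly n (quot (suc n) r p) s ≈ 0#
  factor-at-roots n p r s p[r]≈0 p[s]≈0 = begin
    (s - r) * evalPoly n (quot (suc n) r p) s                              ≈⟨ sym (+-identityˡ _) ⟩
    0# + (s - r) * evalPoly n (quot (suc n) r p) s                         ≈⟨ +-congʳ (sym p[r]≈0) ⟩
    evalPoly (suc n) p r + (s - r) * evalPoly n (quot (suc n) r p) s       ≈⟨ sym (evalPoly-factor n p r s) ⟩
    evalPoly (suc n) p s                                                   ≈⟨ p[s]≈0 ⟩
    0#                                                                     ∎

  double-root-if-quot-root : ∀ n p r → evalPoly (suc n) p r ≈ 0# → evalPoly n (quot (suc n) r p) r ≈ 0# → HasDoubleRoot (suc n) p
  double-root-if-quot-root n p r p[r]≈0 q[r]≈0 = r , p[r]≈0 , trans (sym (evalPoly-quot-at-r n p r)) q[r]≈0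

  root-with-zero-quot⇒zero : ∀ n r p → (∀ i → i ℕ.< n → quot (suc n) r p i ≈ 0#) → evalPoly (suc n) p r ≈ 0# →
                             ∀ i → i ℕ.< suc n → p i ≈ 0#
  root-with-zero-quot⇒zero zero    r p q≈0 pr≈0 zero    _ = trans (sym (trans (+-congˡ (zeroʳ r)) (+-identityʳ _))) pr≈0
  root-with-zero-quot⇒zero zero    r p q≈0 pr≈0 (suc i) (s≤s ())
  root-with-zero-quot⇒zero (suc n) r p q≈0 pr≈0 zero    _ =
    trans (sym (trans (+-congˡ (trans (*-congˡ (q≈0 0 (s≤s z≤n))) (zeroʳ r))) (+-identityʳ _))) pr≈0
  root-with-zero-quot⇒zero (suc n) r p q≈0 pr≈0 (suc i) (s≤s i<n) =
    root-with-zero-quot⇒zero n r (λ j → p (suc j)) (λ j j<n → q≈0 (suc j) (s≤s j<n)) (q≈0 0 (s≤s z≤n)) i i<n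

  -- Divide by t - k: as j - k is invertible, the quotient vanishes at every j > k.
  vanishing-on-ℕ⇒zero : ∀ n p k → (∀ j → k ℕ.≤ j → evalPoly n p (fromℕ j) ≈ 0#) → ∀ i → i ℕ.< n → p i ≈ 0#
  vanishing-on-ℕ⇒zero zero    p k vanish i ()
  vanishing-on-ℕ⇒zero (suc n) p k vanish =
    root-with-zero-quot⇒zero n (fromℕ k) p (vanishing-on-ℕ⇒zero n (quot (suc n) (fromℕ k) p) (suc k) quot-vanish) (vanish k ℕP.≤-refl)
    where
    quot-vanish : ∀ j → suc k ℕ.≤ j → evalPoly n (quot (suc n) (fromℕ k) p) (fromℕ j) ≈ 0#
    quot-vanish j k<j = fromℕ-sub-cancelˡ (λ j≡k → ℕP.<-irrefl (P.sym j≡k) k<j)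
      (factor-at-roots n p (fromℕ k) (fromℕ j) (vanish k ℕP.≤-refl) (vanish j (ℕP.<⇒≤ k<j)))

  agreeing-on-ℕ⇒equal : ∀ n p q → (∀ j → evalPoly n p (fromℕ j) ≈ evalPoly n q (fromℕ j)) → ∀ i → i ℕ.< n → p i ≈ q i
  agreeing-on-ℕ⇒equal n p q agree i i<n = x-y≈0⇒x≈y _ _
    (vanishing-on-ℕ⇒zero n (λ i → p i - q i) 0 (λ j _ → trans (evalPoly-sub n p q (fromℕ j)) (x≈y⇒x-y≈0 (agree j))) i i<n)

module BinaryForms {c ℓ} (A : Commutativeℚ-Algebra c ℓ) where
  open Properties A
  open Polynomials A

  evalForm-[x] : ∀ a X Y → evalForm 0 (a ∷ []) X Y ≈ a
  evalForm-[x] a X Y = trans (+-identityʳ _) (trans (*-congˡ (*-identityʳ 1#)) (*-identityʳ a))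

  evalForm-∷ : ∀ n a (v : Vec Carrier (suc n)) X Y → evalForm (suc n) (a ∷ v) X Y ≈ a * pow X (suc n) + Y * evalForm n v X Y
  evalForm-∷ n a v X Y = +-cong (*-congˡ (*-identityʳ _))
    (trans (∑-cong (suc n) (λ i → solve 4 (λ a b c d → a :* (b :* (c :* d)) := c :* (a :* (b :* d))) refl
                                    (Vec.lookup v i) (pow X (n ∸ toℕ i)) Y (pow Y (toℕ i))))
           (∑-distribˡ-* (suc n) Y (λ i → Vec.lookup v i * (pow X (n ∸ toℕ i) * pow Y (toℕ i)))))

  evalForm-cong : ∀ n (v : Vec Carrier (suc n)) {X X′ Y Y′} → X ≈ X′ → Y ≈ Y′ → evalForm n v X Y ≈ evalForm n v X′ Y′
  evalForm-cong n v X≈X′ Y≈Y′ = ∑-cong (suc n) (λ i → *-congˡ {Vec.lookup v i} (*-cong (pow-cong (n ∸ toℕ i) X≈X′) (pow-cong (toℕ i) Y≈Y′)))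

  evalForm-congᶜ : ∀ n (v w : Vec Carrier (suc n)) X Y → (∀ i → Vec.lookup v i ≈ Vec.lookup w i) → evalForm n v X Y ≈ evalForm n w X Y
  evalForm-congᶜ n v w X Y v≈w = ∑-cong (suc n) (λ i → *-congʳ {pow X (n ∸ toℕ i) * pow Y (toℕ i)} (v≈w i))

  evalForm-homogeneous : ∀ n (v : Vec Carrier (suc n)) s X Y → evalForm n v (s * X) (s * Y) ≈ pow s n * evalForm n v X Y
  evalForm-homogeneous zero (a ∷ []) s X Y =
    trans (evalForm-[x] a (s * X) (s * Y)) (trans (sym (*-identityˡ a)) (*-congˡ (sym (evalForm-[x] a X Y))))
  evalForm-homogeneous (suc n) (a ∷ v) s X Y = begin
    evalForm (suc n) (a ∷ v) (s * X) (s * Y)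
      ≈⟨ evalForm-∷ n a v (s * X) (s * Y) ⟩
    a * pow (s * X) (suc n) + s * Y * evalForm n v (s * X) (s * Y)
      ≈⟨ +-cong (*-congˡ (pow-distrib-* s X (suc n))) (*-congˡ (evalForm-homogeneous n v s X Y)) ⟩
    a * (pow s (suc n) * pow X (suc n)) + s * Y * (pow s n * evalForm n v X Y)
      ≈⟨ solve 6 (λ a l ln Xn Y e → a :* (l :* ln :* Xn) :+ l :* Y :* (ln :* e) := l :* ln :* (a :* Xn :+ Y :* e)) refl
           a s (pow s n) (pow X (suc n)) Y (evalForm n v X Y) ⟩
    pow s (suc n) * (a * pow X (suc n) + Y * evalForm n v X Y)
      ≈⟨ *-congˡ (sym (evalForm-∷ n a v X Y)) ⟩
    pow s (suc n) * evalForm (suc n) (a ∷ v) X Y ∎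

  coeff : ∀ {n} → Vec Carrier n → ℕ → Carrier
  coeff []      _       = 0#
  coeff (a ∷ v) zero    = a
  coeff (a ∷ v) (suc i) = coeff v i

  lookup≡coeff : ∀ {n} (v : Vec Carrier n) i → Vec.lookup v i ≡ coeff v (toℕ i)
  lookup≡coeff (a ∷ v) zero    = P.refl
  lookup≡coeff (a ∷ v) (suc i) = lookup≡coeff v i

  evalForm-at-1 : ∀ n (v : Vec Carrier (suc n)) t → evalForm n v 1# t ≈ evalPoly (suc n) (coeff v) t
  evalForm-at-1 zero (a ∷ []) t = trans (evalForm-[x] a 1# t) (sym (trans (+-congˡ (zeroʳ t)) (+-identityʳ a)))
  evalForm-at-1 (suc n) (a ∷ v) t =
    trans (evalForm-∷ n a v 1# t) (+-cong (trans (*-congˡ (pow-1 (suc n))) (*-identityʳ a)) (*-congˡ (evalForm-at-1 n v t)))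

  vanishing-on-ℕ⇒coeff≈0 : ∀ n (v : Vec Carrier (suc n)) → (∀ j → evalForm n v 1# (fromℕ j) ≈ 0#) →
                           ∀ i → i ℕ.< suc n → coeff v i ≈ 0#
  vanishing-on-ℕ⇒coeff≈0 n v vanish = vanishing-on-ℕ⇒zero (suc n) (coeff v) 0
    (λ j _ → trans (sym (evalForm-at-1 n v (fromℕ j))) (vanish j))

  agreeing-on-ℕ⇒equal-forms : ∀ n (v w : Vec Carrier (suc n)) → (∀ j → evalForm n v 1# (fromℕ j) ≈ evalForm n w 1# (fromℕ j)) →
                              ∀ X Y → evalForm n v X Y ≈ evalForm n w X Y
  agreeing-on-ℕ⇒equal-forms n v w agree X Y = evalForm-congᶜ n v w X Y (λ i →
    P.subst₂ _≈_ (P.sym (lookup≡coeff v i)) (P.sym (lookup≡coeff w i))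
      (agreeing-on-ℕ⇒equal (suc n) (coeff v) (coeff w)
        (λ j → trans (sym (evalForm-at-1 n v (fromℕ j))) (trans (agree j) (evalForm-at-1 n w (fromℕ j))))
        (toℕ i) (FinP.toℕ<n i)))

  ι-evalForm : ∀ n (v : Vec ℚ (suc n)) X Y → ι (Q.evalForm n v X Y) ≈ evalForm n (Vec.map ι v) (ι X) (ι Y)
  ι-evalForm n v X Y = trans (ι-∑ (suc n) (λ i → Vec.lookup v i ℚ.* (Q.pow X (n ∸ toℕ i) ℚ.* Q.pow Y (toℕ i))))
    (∑-cong (suc n) (λ i → trans (ι-* (Vec.lookup v i) _) (*-cong (reflexive (P.sym (VecP.lookup-map i ι v)))
      (trans (ι-* (Q.pow X (n ∸ toℕ i)) _) (*-cong (ι-pow X (n ∸ toℕ i)) (ι-pow Y (toℕ i)))))))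

  coeff-map-ι : ∀ {n} (v : Vec ℚ n) i → coeff (Vec.map ι v) i ≈ ι (coef v i)
  coeff-map-ι []      i       = sym ι-0
  coeff-map-ι (a ∷ v) zero    = refl
  coeff-map-ι (a ∷ v) (suc i) = coeff-map-ι v i

  evalForm-zipWith-+ : ∀ n (v w : Vec Carrier (suc n)) X Y →
                       evalForm n (Vec.zipWith _+_ v w) X Y ≈ evalForm n v X Y + evalForm n w X Y
  evalForm-zipWith-+ n v w X Y = trans
    (∑-cong (suc n) (λ i → trans (*-congʳ (reflexive (VecP.lookup-zipWith _+_ i v w))) (distribʳ (m i) _ _)))
    (∑-distrib-+ (suc n) (λ i → Vec.lookup v i * m i) (λ i → Vec.lookup w i * m i))
    where
    m : Fin (suc n) → Carrier
    m i = pow X (n ∸ toℕ i) * pow Y (toℕ i)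

  evalForm-map-* : ∀ n a (v : Vec Carrier (suc n)) X Y → evalForm n (Vec.map (a *_) v) X Y ≈ a * evalForm n v X Y
  evalForm-map-* n a v X Y = trans
    (∑-cong (suc n) (λ i → trans (*-congʳ (reflexive (VecP.lookup-map i (a *_) v))) (*-assoc a (Vec.lookup v i) (m i))))
    (∑-distribˡ-* (suc n) a (λ i → Vec.lookup v i * m i))
    where
    m : Fin (suc n) → Carrier
    m i = pow X (n ∸ toℕ i) * pow Y (toℕ i)

  evalForm-∷ʳ0 : ∀ n (v : Vec Carrier (suc n)) X Y → evalForm (suc n) (v Vec.∷ʳ 0#) X Y ≈ X * evalForm n v X Y
  evalForm-∷ʳ0 zero (a ∷ []) X Y = begin
    evalForm 1 (a ∷ 0# ∷ []) X Y              ≈⟨ evalForm-∷ 0 a (0# ∷ []) X Y ⟩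
    a * pow X 1 + Y * evalForm 0 (0# ∷ []) X Y ≈⟨ +-cong (*-congˡ (*-identityʳ X)) (*-congˡ (evalForm-[x] 0# X Y)) ⟩
    a * X + Y * 0#                             ≈⟨ trans (+-congˡ (zeroʳ Y)) (trans (+-identityʳ _) (*-comm a X)) ⟩
    X * a                                      ≈⟨ *-congˡ (sym (evalForm-[x] a X Y)) ⟩
    X * evalForm 0 (a ∷ []) X Y                ∎
  evalForm-∷ʳ0 (suc n) (a ∷ v) X Y = begin
    evalForm (suc (suc n)) (a ∷ (v Vec.∷ʳ 0#)) X Y
      ≈⟨ evalForm-∷ (suc n) a (v Vec.∷ʳ 0#) X Y ⟩
    a * pow X (suc (suc n)) + Y * evalForm (suc n) (v Vec.∷ʳ 0#) X Y
      ≈⟨ +-congˡ (*-congˡ (evalForm-∷ʳ0 n v X Y)) ⟩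
    a * (X * pow X (suc n)) + Y * (X * evalForm n v X Y)
      ≈⟨ solve 5 (λ a X p Y e → a :* (X :* p) :+ Y :* (X :* e) := X :* (a :* p :+ Y :* e)) refl a X (pow X (suc n)) Y (evalForm n v X Y) ⟩
    X * (a * pow X (suc n) + Y * evalForm n v X Y)
      ≈⟨ *-congˡ (sym (evalForm-∷ n a v X Y)) ⟩
    X * evalForm (suc n) (a ∷ v) X Y ∎

  evalForm-0∷ : ∀ n (v : Vec Carrier (suc n)) X Y → evalForm (suc n) (0# ∷ v) X Y ≈ Y * evalForm n v X Y
  evalForm-0∷ n v X Y = trans (evalForm-∷ n 0# v X Y) (trans (+-congʳ (zeroˡ _)) (+-identityˡ _))

  mulByLinear : ∀ {n} → Carrier → Carrier → Vec Carrier (suc n) → Vec Carrier (suc (suc n))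
  mulByLinear a b w = Vec.zipWith _+_ (Vec.map (a *_) w Vec.∷ʳ 0#) (0# ∷ Vec.map (b *_) w)

  evalForm-mulByLinear : ∀ n a b (w : Vec Carrier (suc n)) X Y →
                         evalForm (suc n) (mulByLinear a b w) X Y ≈ (a * X + b * Y) * evalForm n w X Y
  evalForm-mulByLinear n a b w X Y = begin
    evalForm (suc n) (mulByLinear a b w) X Y
      ≈⟨ evalForm-zipWith-+ (suc n) (Vec.map (a *_) w Vec.∷ʳ 0#) (0# ∷ Vec.map (b *_) w) X Y ⟩
    evalForm (suc n) (Vec.map (a *_) w Vec.∷ʳ 0#) X Y + evalForm (suc n) (0# ∷ Vec.map (b *_) w) X Y
      ≈⟨ +-cong (evalForm-∷ʳ0 n (Vec.map (a *_) w) X Y) (evalForm-0∷ n (Vec.map (b *_) w) X Y) ⟩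
    X * evalForm n (Vec.map (a *_) w) X Y + Y * evalForm n (Vec.map (b *_) w) X Y
      ≈⟨ +-cong (*-congˡ (evalForm-map-* n a w X Y)) (*-congˡ (evalForm-map-* n b w X Y)) ⟩
    X * (a * evalForm n w X Y) + Y * (b * evalForm n w X Y)
      ≈⟨ solve 5 (λ X Y a b e → X :* (a :* e) :+ Y :* (b :* e) := (a :* X :+ b :* Y) :* e) refl X Y a b (evalForm n w X Y) ⟩
    (a * X + b * Y) * evalForm n w X Y ∎

  linearPower : ∀ k → Carrier → Carrier → Vec Carrier (suc k)
  linearPower zero    a b = 1# ∷ []
  linearPower (suc k) a b = mulByLinear a b (linearPower k a b)

  evalForm-linearPower : ∀ k a b X Y → evalForm k (linearPower k a b) X Y ≈ pow (a * X + b * Y) k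
  evalForm-linearPower zero    a b X Y = evalForm-[x] 1# X Y
  evalForm-linearPower (suc k) a b X Y =
    trans (evalForm-mulByLinear k a b (linearPower k a b) X Y) (*-congˡ (evalForm-linearPower k a b X Y))

  composeCoeffs : ∀ n → Vec Carrier (suc n) → Mat2 → Vec Carrier (suc n)
  composeCoeffs zero    (a ∷ []) γ = a ∷ []
  composeCoeffs (suc n) (a ∷ v)  γ@(mat u1 u2 u3 u4) =
    Vec.zipWith _+_ (Vec.map (a *_) (linearPower (suc n) u1 u2)) (mulByLinear u3 u4 (composeCoeffs n v γ))

  evalForm-composeCoeffs : ∀ n v γ X Y → evalForm n (composeCoeffs n v γ) X Y ≈ compose n v γ X Y
  evalForm-composeCoeffs zero (a ∷ []) γ@(mat u1 u2 u3 u4) X Y =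
    trans (evalForm-[x] a X Y) (sym (evalForm-[x] a (u1 * X + u2 * Y) (u3 * X + u4 * Y)))
  evalForm-composeCoeffs (suc n) (a ∷ v) γ@(mat u1 u2 u3 u4) X Y = begin
    evalForm (suc n) (composeCoeffs (suc n) (a ∷ v) γ) X Y
      ≈⟨ evalForm-zipWith-+ (suc n) (Vec.map (a *_) (linearPower (suc n) u1 u2)) (mulByLinear u3 u4 (composeCoeffs n v γ)) X Y ⟩
    evalForm (suc n) (Vec.map (a *_) (linearPower (suc n) u1 u2)) X Y + evalForm (suc n) (mulByLinear u3 u4 (composeCoeffs n v γ)) X Y
      ≈⟨ +-cong (trans (evalForm-map-* (suc n) a (linearPower (suc n) u1 u2) X Y) (*-congˡ (evalForm-linearPower (suc n) u1 u2 X Y)))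
                (trans (evalForm-mulByLinear n u3 u4 (composeCoeffs n v γ) X Y) (*-congˡ (evalForm-composeCoeffs n v γ X Y))) ⟩
    a * pow (u1 * X + u2 * Y) (suc n) + (u3 * X + u4 * Y) * evalForm n v (u1 * X + u2 * Y) (u3 * X + u4 * Y)
      ≈⟨ sym (evalForm-∷ n a v (u1 * X + u2 * Y) (u3 * X + u4 * Y)) ⟩
    evalForm (suc n) (a ∷ v) (u1 * X + u2 * Y) (u3 * X + u4 * Y) ∎

  compose-cong : ∀ n v γ {X X′ Y Y′} → X ≈ X′ → Y ≈ Y′ → compose n v γ X Y ≈ compose n v γ X′ Y′
  compose-cong n v (mat u1 u2 u3 u4) X≈X′ Y≈Y′ =
    evalForm-cong n v (+-cong (*-congˡ X≈X′) (*-congˡ Y≈Y′)) (+-cong (*-congˡ X≈X′) (*-congˡ Y≈Y′))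

data Adjacent : ∀ {n} → Fin n → Fin n → Set where
  adjacent-zero : ∀ {n} → Adjacent {suc (suc n)} zero (suc zero)
  adjacent-suc  : ∀ {n} {i j : Fin n} → Adjacent i j → Adjacent (suc i) (suc j)

adjacent-toℕ : ∀ {n} {k k′ : Fin n} → Adjacent k k′ → toℕ k′ ≡ suc (toℕ k)
adjacent-toℕ adjacent-zero    = P.refl
adjacent-toℕ (adjacent-suc a) = P.cong suc (adjacent-toℕ a)

adjacent-≢ : ∀ {n} {k k′ : Fin n} → Adjacent k k′ → k ≢ k′
adjacent-≢ adjacent-zero    ()
adjacent-≢ (adjacent-suc a) e = adjacent-≢ a (FinP.suc-injective e)

adjacent-inject₁ : ∀ {n} (k : Fin n) → Adjacent (inject₁ k) (suc k)
adjacent-inject₁ zero    = adjacent-zero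
adjacent-inject₁ (suc k) = adjacent-suc (adjacent-inject₁ k)

adjacent-punchOut : ∀ {n} {j k k′ : Fin (suc n)} → Adjacent k k′ → (j≢k : j ≢ k) (j≢k′ : j ≢ k′) →
                    Adjacent (punchOut j≢k) (punchOut j≢k′)
adjacent-punchOut {j = zero}      adjacent-zero j≢k j≢k′ = ⊥-elim (j≢k P.refl)
adjacent-punchOut {j = suc zero}  adjacent-zero j≢k j≢k′ = ⊥-elim (j≢k′ P.refl)
adjacent-punchOut {n = suc (suc _)} {j = suc (suc j)} adjacent-zero j≢k j≢k′ = adjacent-zero
adjacent-punchOut {n = suc zero}    {j = suc (suc ())} adjacent-zero j≢k j≢k′
adjacent-punchOut {j = zero}      (adjacent-suc a) j≢k j≢k′ = a
adjacent-punchOut {n = suc _} {j = suc j} (adjacent-suc a) j≢k j≢k′ =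
  adjacent-suc (adjacent-punchOut {j = j} a (λ e → j≢k (P.cong suc e)) (λ e → j≢k′ (P.cong suc e)))

punchIn-adjacent : ∀ {n} {k k′ : Fin (suc n)} → Adjacent k k′ → ∀ l →
                   (punchIn k l ≡ punchIn k′ l) ⊎ (punchIn k l ≡ k′ × punchIn k′ l ≡ k)
punchIn-adjacent adjacent-zero    zero    = inj₂ (P.refl , P.refl)
punchIn-adjacent adjacent-zero    (suc l) = inj₁ P.refl
punchIn-adjacent (adjacent-suc a) zero    = inj₁ P.refl
punchIn-adjacent (adjacent-suc a) (suc l) with punchIn-adjacent a l
... | inj₁ e         = inj₁ (P.cong suc e)
... | inj₂ (e₁ , e₂) = inj₂ (P.cong suc e₁ , P.cong suc e₂)

module Determinants {c ℓ} (A : Commutativeℚ-Algebra c ℓ) where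
  open Properties A

  Mat : ℕ → Set c
  Mat n = Fin n → Fin n → Carrier

  minor : ∀ {n} → Mat (suc n) → Fin (suc n) → Mat n
  minor M j i k = M (suc i) (punchIn j k)

  expansionTerm : ∀ {n} → Mat (suc n) → Fin (suc n) → Carrier
  expansionTerm M j = sgn (toℕ j) * (M zero j * det _ (minor M j))

  ∑-adjacent-pair : ∀ {n} {k k′ : Fin n} → Adjacent k k′ → (f : Fin n → Carrier) →
                    (∀ j → j ≢ k → j ≢ k′ → f j ≈ 0#) → f k + f k′ ≈ 0# → ∑ n f ≈ 0#
  ∑-adjacent-pair {suc (suc n)} adjacent-zero f others≈0 pair≈0 =
    trans (sym (+-assoc _ _ _)) (trans (+-cong pair≈0 (∑-zero n _ (λ i → others≈0 (suc (suc i)) (λ ()) (λ ())))) (+-identityʳ 0#))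
  ∑-adjacent-pair {suc n} (adjacent-suc a) f others≈0 pair≈0 =
    trans (+-cong (others≈0 zero (λ ()) (λ ()))
                  (∑-adjacent-pair a (λ i → f (suc i)) (λ j p q → others≈0 (suc j) (p ∘ FinP.suc-injective) (q ∘ FinP.suc-injective)) pair≈0))
          (+-identityʳ 0#)

  det-cong : ∀ n (M N : Mat n) → (∀ i j → M i j ≈ N i j) → det n M ≈ det n N
  det-cong zero    M N M≈N = refl
  det-cong (suc n) M N M≈N = ∑-cong (suc n) (λ j → *-congˡ {sgn (toℕ j)}
    (*-cong (M≈N zero j) (det-cong n (minor M j) (minor N j) (λ i k → M≈N (suc i) (punchIn j k)))))

  private
    punchIn≢ : ∀ {n} {j k : Fin (suc n)} (j≢k : j ≢ k) l → l ≢ punchOut j≢k → punchIn j l ≢ k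
    punchIn≢ {j = j} j≢k l l≢ e = l≢ (FinP.punchIn-injective j l (punchOut j≢k) (P.trans e (P.sym (FinP.punchIn-punchOut j≢k))))

  det-linear-column : ∀ n (M M₁ M₂ : Mat n) (k : Fin n) a →
    (∀ r j → j ≢ k → M₁ r j ≈ M r j) → (∀ r j → j ≢ k → M₂ r j ≈ M r j) →
    (∀ r → M r k ≈ M₁ r k + a * M₂ r k) → det n M ≈ det n M₁ + a * det n M₂
  det-linear-column (suc n) M M₁ M₂ k a M₁≈M M₂≈M column-k = begin
    ∑ (suc n) (expansionTerm M)                                   ≈⟨ ∑-cong (suc n) split ⟩
    ∑ (suc n) (λ j → expansionTerm M₁ j + a * expansionTerm M₂ j) ≈⟨ ∑-distrib-+ (suc n) (expansionTerm M₁) (λ j → a * expansionTerm M₂ j) ⟩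
    ∑ (suc n) (expansionTerm M₁) + ∑ (suc n) (λ j → a * expansionTerm M₂ j) ≈⟨ +-congˡ (∑-distribˡ-* (suc n) a (expansionTerm M₂)) ⟩
    ∑ (suc n) (expansionTerm M₁) + a * ∑ (suc n) (expansionTerm M₂) ∎
    where
    split : ∀ j → expansionTerm M j ≈ expansionTerm M₁ j + a * expansionTerm M₂ j
    split j with j Fin.≟ k
    ... | yes P.refl = begin
      sgn (toℕ j) * (M zero j * det n (minor M j))
        ≈⟨ *-congˡ (*-cong (column-k zero) (det-cong n _ _ (λ i l → sym (M₁≈M (suc i) (punchIn j l) (FinP.punchInᵢ≢i j l))))) ⟩
      sgn (toℕ j) * ((M₁ zero j + a * M₂ zero j) * det n (minor M₁ j))
        ≈⟨ solve 5 (λ s x a y d → s :* ((x :+ a :* y) :* d) := s :* (x :* d) :+ a :* (s :* (y :* d))) refl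
             (sgn (toℕ j)) (M₁ zero j) a (M₂ zero j) (det n (minor M₁ j)) ⟩
      sgn (toℕ j) * (M₁ zero j * det n (minor M₁ j)) + a * (sgn (toℕ j) * (M₂ zero j * det n (minor M₁ j)))
        ≈⟨ +-congˡ (*-congˡ (*-congˡ (*-congˡ (det-cong n _ _ (λ i l →
             trans (M₁≈M (suc i) (punchIn j l) (FinP.punchInᵢ≢i j l)) (sym (M₂≈M (suc i) (punchIn j l) (FinP.punchInᵢ≢i j l)))))))) ⟩
      sgn (toℕ j) * (M₁ zero j * det n (minor M₁ j)) + a * (sgn (toℕ j) * (M₂ zero j * det n (minor M₂ j))) ∎
    ... | no j≢k = begin
      sgn (toℕ j) * (M zero j * det n (minor M j))
        ≈⟨ *-congˡ (*-congˡ (det-linear-column n (minor M j) (minor M₁ j) (minor M₂ j) (punchOut j≢k) a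
             (λ r l l≢ → M₁≈M (suc r) (punchIn j l) (punchIn≢ j≢k l l≢))
             (λ r l l≢ → M₂≈M (suc r) (punchIn j l) (punchIn≢ j≢k l l≢))
             (λ r → P.subst (λ z → M (suc r) z ≈ M₁ (suc r) z + a * M₂ (suc r) z) (P.sym (FinP.punchIn-punchOut j≢k)) (column-k (suc r))))) ⟩
      sgn (toℕ j) * (M zero j * (det n (minor M₁ j) + a * det n (minor M₂ j)))
        ≈⟨ solve 5 (λ s m x a y → s :* (m :* (x :+ a :* y)) := s :* (m :* x) :+ a :* (s :* (m :* y))) refl
             (sgn (toℕ j)) (M zero j) (det n (minor M₁ j)) a (det n (minor M₂ j)) ⟩
      sgn (toℕ j) * (M zero j * det n (minor M₁ j)) + a * (sgn (toℕ j) * (M zero j * det n (minor M₂ j)))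
        ≈⟨ +-cong (*-congˡ (*-congʳ (sym (M₁≈M zero j j≢k)))) (*-congˡ (*-congˡ (*-congʳ (sym (M₂≈M zero j j≢k))))) ⟩
      sgn (toℕ j) * (M₁ zero j * det n (minor M₁ j)) + a * (sgn (toℕ j) * (M₂ zero j * det n (minor M₂ j))) ∎

  det-equal-adjacent-columns : ∀ n (M : Mat n) {k k′ : Fin n} → Adjacent k k′ → (∀ r → M r k ≈ M r k′) → det n M ≈ 0#
  det-equal-adjacent-columns (suc n) M {k} {k′} adj k≈k′ = ∑-adjacent-pair adj (expansionTerm M) others≈0 pair≈0
    where
    others≈0 : ∀ j → j ≢ k → j ≢ k′ → expansionTerm M j ≈ 0#
    others≈0 j j≢k j≢k′ = trans (*-congˡ (*-congˡ (det-equal-adjacent-columns n (minor M j) (adjacent-punchOut adj j≢k j≢k′)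
       (λ r → P.subst₂ (λ u v → M (suc r) u ≈ M (suc r) v)
                (P.sym (FinP.punchIn-punchOut j≢k)) (P.sym (FinP.punchIn-punchOut j≢k′)) (k≈k′ (suc r))))))
       (trans (*-congˡ (zeroʳ _)) (zeroʳ _))
    minors≈ : det n (minor M k′) ≈ det n (minor M k)
    minors≈ = det-cong n _ _ (λ i l → entry i l (punchIn-adjacent adj l))
      where
      entry : ∀ i l → (punchIn k l ≡ punchIn k′ l) ⊎ (punchIn k l ≡ k′ × punchIn k′ l ≡ k) →
              M (suc i) (punchIn k′ l) ≈ M (suc i) (punchIn k l)
      entry i l (inj₁ e)         = reflexive (P.cong (M (suc i)) (P.sym e))
      entry i l (inj₂ (e₁ , e₂)) = P.subst₂ (λ u v → M (suc i) u ≈ M (suc i) v) (P.sym e₂) (P.sym e₁) (k≈k′ (suc i))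
    pair≈0 : expansionTerm M k + expansionTerm M k′ ≈ 0#
    pair≈0 = begin
      sgn (toℕ k) * (M zero k * det n (minor M k)) + sgn (toℕ k′) * (M zero k′ * det n (minor M k′))
        ≈⟨ +-congˡ (*-cong (reflexive (P.cong sgn (adjacent-toℕ adj))) (*-cong (sym (k≈k′ zero)) minors≈)) ⟩
      sgn (toℕ k) * (M zero k * det n (minor M k)) + - sgn (toℕ k) * (M zero k * det n (minor M k))
        ≈⟨ solve 3 (λ s m d → s :* (m :* d) :+ (:- s) :* (m :* d) := con 0ℚ) refl (sgn (toℕ k)) (M zero k) (det n (minor M k)) ⟩
      ι 0ℚ ≈⟨ ι-0 ⟩
      0# ∎

  det-zero-column : ∀ n (M : Mat n) k → (∀ r → M r k ≈ 0#) → det n M ≈ 0#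
  det-zero-column (suc n) M k column≈0 = ∑-zero (suc n) (expansionTerm M) term≈0
    where
    term≈0 : ∀ j → expansionTerm M j ≈ 0#
    term≈0 j with j Fin.≟ k
    ... | yes P.refl = trans (*-congˡ (trans (*-congʳ (column≈0 zero)) (zeroˡ _))) (zeroʳ _)
    ... | no j≢k     = trans (*-congˡ (trans (*-congˡ (det-zero-column n (minor M j) (punchOut j≢k)
                         (λ r → trans (reflexive (P.cong (M (suc r)) (FinP.punchIn-punchOut j≢k))) (column≈0 (suc r)))))
                         (zeroʳ _))) (zeroʳ _)

  replaceColumn : ∀ {n} → Fin n → (Fin n → Carrier) → Mat n → Mat n
  replaceColumn k u M r j with j Fin.≟ k
  ... | yes _ = u r
  ... | no _  = M r j

  replaceColumn-at : ∀ {n} (k : Fin n) u M r → replaceColumn k u M r k ≡ u r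
  replaceColumn-at k u M r with k Fin.≟ k
  ... | yes _  = P.refl
  ... | no k≢k = ⊥-elim (k≢k P.refl)

  replaceColumn-off : ∀ {n} (k : Fin n) u M r j → j ≢ k → replaceColumn k u M r j ≡ M r j
  replaceColumn-off k u M r j j≢k with j Fin.≟ k
  ... | yes j≡k = ⊥-elim (j≢k j≡k)
  ... | no _    = P.refl

  det-add-next-column : ∀ n (M : Mat n) {k k′ : Fin n} → Adjacent k k′ → ∀ a →
    det n (replaceColumn k (λ r → M r k + a * M r k′) M) ≈ det n M
  det-add-next-column n M {k} {k′} adj a = begin
    det n M⁺
      ≈⟨ det-linear-column n M⁺ M B k a
           (λ r j j≢k → sym (reflexive (replaceColumn-off k u⁺ M r j j≢k)))
           (λ r j j≢k → reflexive (P.trans (replaceColumn-off k u M r j j≢k) (P.sym (replaceColumn-off k u⁺ M r j j≢k))))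
           (λ r → reflexive (P.trans (replaceColumn-at k u⁺ M r) (P.cong (λ x → M r k + a * x) (P.sym (replaceColumn-at k u M r))))) ⟩
    det n M + a * det n B
      ≈⟨ +-congˡ (*-congˡ (det-equal-adjacent-columns n B adj (λ r → reflexive
           (P.trans (replaceColumn-at k u M r) (P.sym (replaceColumn-off k u M r k′ (adjacent-≢ adj ∘ P.sym))))))) ⟩
    det n M + a * 0#
      ≈⟨ trans (+-congˡ (zeroʳ a)) (+-identityʳ _) ⟩
    det n M ∎
    where
    u u⁺ : Fin n → Carrier
    u r  = M r k′
    u⁺ r = M r k + a * M r k′
    M⁺ B : Mat n
    M⁺ = replaceColumn k u⁺ M
    B  = replaceColumn k u M

  ∑upTo : ∀ {n} → Fin n → (Fin n → Carrier) → Carrier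
  ∑upTo zero    f = f zero
  ∑upTo (suc k) f = f zero + ∑upTo k (λ i → f (suc i))

  ∑upTo-adjacent : ∀ {n} {k k′ : Fin n} → Adjacent k k′ → ∀ f → ∑upTo k′ f ≈ ∑upTo k f + f k′
  ∑upTo-adjacent adjacent-zero    f = refl
  ∑upTo-adjacent (adjacent-suc a) f = trans (+-congˡ (∑upTo-adjacent a (λ i → f (suc i)))) (sym (+-assoc _ _ _))

  ∑upTo-change-last : ∀ {n} (k : Fin n) f g x → (∀ j → j ≢ k → g j ≈ f j) → g k ≈ f k + x → ∑upTo k g ≈ ∑upTo k f + x
  ∑upTo-change-last zero    f g x g≈f gk≈ = gk≈
  ∑upTo-change-last (suc k) f g x g≈f gk≈ = trans
    (+-cong (g≈f zero (λ ())) (∑upTo-change-last k _ _ x (λ j j≢k → g≈f (suc j) (j≢k ∘ FinP.suc-injective)) gk≈))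
    (sym (+-assoc _ _ _))

  ∑≈∑upTo-fromℕ : ∀ n f → ∑ (suc n) f ≈ ∑upTo (Fin.fromℕ n) f
  ∑≈∑upTo-fromℕ zero    f = +-identityʳ _
  ∑≈∑upTo-fromℕ (suc n) f = +-congˡ (∑≈∑upTo-fromℕ n (λ i → f (suc i)))

  -- Adding t times column k+1 to column k, from the right, turns column 0 into ∑ⱼ tʲ (column j).
  private
    det-prefix-kernel : ∀ N t m (k : Fin N) → toℕ k ≡ m → (M : Mat N) →
                        (∀ r → ∑upTo k (λ j → M r j * pow t (toℕ j)) ≈ 0#) → det N M ≈ 0#
    det-prefix-kernel N t zero zero _ M kernel = det-zero-column N M zero (λ r → trans (sym (*-identityʳ _)) (kernel r))
    det-prefix-kernel (suc N) t (suc m) (suc k″) k≡m M kernel = begin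
      det (suc N) M  ≈⟨ sym (det-add-next-column (suc N) M adj t) ⟩
      det (suc N) M′ ≈⟨ det-prefix-kernel (suc N) t m k (P.trans (FinP.toℕ-inject₁ k″) (ℕP.suc-injective k≡m)) M′ kernel′ ⟩
      0#             ∎
      where
      k : Fin (suc N)
      k = inject₁ k″
      adj : Adjacent k (suc k″)
      adj = adjacent-inject₁ k″
      u : Fin (suc N) → Carrier
      u r = M r k + t * M r (suc k″)
      M′ : Mat (suc N)
      M′ = replaceColumn k u M
      kernel′ : ∀ r → ∑upTo k (λ j → M′ r j * pow t (toℕ j)) ≈ 0#
      kernel′ r = begin
        ∑upTo k (λ j → M′ r j * pow t (toℕ j))
          ≈⟨ ∑upTo-change-last k (λ j → M r j * pow t (toℕ j)) _ (M r (suc k″) * pow t (toℕ (suc k″)))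
               (λ j j≢k → *-congʳ (reflexive (replaceColumn-off k u M r j j≢k)))
               (trans (*-congʳ (reflexive (replaceColumn-at k u M r)))
                 (trans (solve 4 (λ x t y p → (x :+ t :* y) :* p := x :* p :+ y :* (t :* p)) refl (M r k) t (M r (suc k″)) (pow t (toℕ k)))
                   (+-congˡ (*-congˡ (reflexive (P.cong (pow t) (P.sym (adjacent-toℕ adj)))))))) ⟩
        ∑upTo k (λ j → M r j * pow t (toℕ j)) + M r (suc k″) * pow t (toℕ (suc k″))
          ≈⟨ sym (∑upTo-adjacent adj (λ j → M r j * pow t (toℕ j))) ⟩
        ∑upTo (suc k″) (λ j → M r j * pow t (toℕ j))
          ≈⟨ kernel r ⟩
        0# ∎

  det-powers-in-kernel : ∀ N (M : Mat (suc N)) t → (∀ r → ∑ (suc N) (λ j → M r j * pow t (toℕ j)) ≈ 0#) → det (suc N) M ≈ 0#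
  det-powers-in-kernel N M t kernel =
    det-prefix-kernel (suc N) t _ (Fin.fromℕ N) P.refl M (λ r → trans (sym (∑≈∑upTo-fromℕ N _)) (kernel r))

  ι-det : ∀ n (M : Fin n → Fin n → ℚ) → ι (Q.det n M) ≈ det n (λ i j → ι (M i j))
  ι-det zero    M = ι-1
  ι-det (suc n) M = trans (ι-∑ (suc n) (λ j → Q.sgn (toℕ j) ℚ.* (M zero j ℚ.* Q.det n (λ i k → M (suc i) (punchIn j k)))))
    (∑-cong (suc n) (λ j → trans (ι-* (Q.sgn (toℕ j)) _) (*-cong (ι-sgn (toℕ j))
      (trans (ι-* (M zero j) _) (*-congˡ (ι-det n (λ i k → M (suc i) (punchIn j k))))))))

-- A row of the Sylvester matrix: the coefficients p 0, …, p m placed in columns s, …, s + m.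
window : ℕ → ℕ → (ℕ → ℚ) → ℕ → ℚ
window s m p col = if (s ℕ.≤ᵇ col) ∧ (col ℕ.≤ᵇ s ℕ.+ m) then p (col ∸ s) else 0ℚ

sylvester-rows : ∀ m p q r →
  (r ℕ.< m × (∀ col → sylvester m p q r col ≡ window r m p col)) ⊎
  (m ℕ.≤ r × (∀ col → sylvester m p q r col ≡ window (r ∸ m) m q col))
sylvester-rows m p q r with r ℕ.<ᵇ m in r<ᵇm
... | true  = inj₁ (ℕP.<ᵇ⇒< r m (P.subst T (P.sym r<ᵇm) tt) , λ _ → P.refl)
... | false = inj₂ (ℕP.≮⇒≥ (λ r<m → P.subst T r<ᵇm (ℕP.<⇒<ᵇ r<m)) , λ _ → P.refl)

<ᵇ-suc : ∀ a b → (a ℕ.<ᵇ suc b) ≡ (a ℕ.≤ᵇ b)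
<ᵇ-suc zero    b = P.refl
<ᵇ-suc (suc a) b = P.refl

window-suc : ∀ s m p col → window (suc s) m p (suc col) ≡ window s m p col
window-suc s m p col rewrite <ᵇ-suc s col | <ᵇ-suc col (s ℕ.+ m) = P.refl

window-0-suc : ∀ m p col → window 0 (suc m) p (suc col) ≡ window 0 m (λ i → p (suc i)) col
window-0-suc m p col rewrite <ᵇ-suc col m = P.refl

window-beyond : ∀ s m p col → (∀ k → m ℕ.≤ k → p k ≡ 0ℚ) → m ℕ.+ s ℕ.≤ col → window s m p col ≡ 0ℚ
window-beyond s m p col p-high≡0 m+s≤col with (s ℕ.≤ᵇ col) ∧ (col ℕ.≤ᵇ s ℕ.+ m)
... | true  = p-high≡0 (col ∸ s) (ℕP.m+n≤o⇒m≤o∸n m m+s≤col)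
... | false = P.refl

private
  beyond-row-end : ∀ m {s} → s ℕ.≤ m → suc m ℕ.+ s ℕ.≤ m ℕ.+ suc m
  beyond-row-end m {s} s≤m = P.subst (suc m ℕ.+ s ℕ.≤_) (P.sym (ℕP.+-suc m m)) (ℕP.+-monoʳ-≤ (suc m) s≤m)

sylvester-last-column : ∀ m p q → (∀ k → suc m ℕ.≤ k → p k ≡ 0ℚ) → (∀ k → suc m ℕ.≤ k → q k ≡ 0ℚ) →
                        ∀ r → r ℕ.< suc m ℕ.+ suc m → sylvester (suc m) p q r (m ℕ.+ suc m) ≡ 0ℚ
sylvester-last-column m p q p-high≡0 q-high≡0 r r<2m with sylvester-rows (suc m) p q r
... | inj₁ (r<m , row) = P.trans (row _) (window-beyond r (suc m) p _ p-high≡0 (beyond-row-end m (ℕP.≤-pred r<m)))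
... | inj₂ (m≤r , row) = P.trans (row _) (window-beyond (r ∸ suc m) (suc m) q _ q-high≡0
                                            (beyond-row-end m (ℕP.≤-pred (ℕP.m<n+o⇒m∸n<o r (suc m) r<2m))))

module Resultants {c ℓ} (A : Commutativeℚ-Algebra c ℓ) where
  open Properties A
  open Polynomials A
  open Determinants A

  private
    evalPoly-window-0 : ∀ m N p t → m ℕ.< N → evalPoly N (λ col → ι (window 0 m p col)) t ≈ evalPoly (suc m) (λ i → ι (p i)) t
    evalPoly-window-0 zero (suc N) p t _ =
      +-congˡ (*-congˡ (evalPoly-zero N _ t (λ _ _ → ι-0)))
    evalPoly-window-0 (suc m) (suc N) p t (s≤s m<N) =
      +-congˡ (*-congˡ (trans (evalPoly-cong N (λ col → reflexive (P.cong ι (window-0-suc m p col))) refl)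
                              (evalPoly-window-0 m N (λ i → p (suc i)) t m<N)))

  evalPoly-window : ∀ s m N p t → s ℕ.+ m ℕ.< N →
                    evalPoly N (λ col → ι (window s m p col)) t ≈ pow t s * evalPoly (suc m) (λ i → ι (p i)) t
  evalPoly-window zero m N p t m<N = trans (evalPoly-window-0 m N p t m<N) (sym (*-identityˡ _))
  evalPoly-window (suc s) m (suc N) p t (s≤s s+m<N) = begin
    ι 0ℚ + t * evalPoly N (λ col → ι (window (suc s) m p (suc col))) t
      ≈⟨ +-cong ι-0 (*-congˡ (evalPoly-cong N (λ col → reflexive (P.cong ι (window-suc s m p col))) refl)) ⟩
    0# + t * evalPoly N (λ col → ι (window s m p col)) t
      ≈⟨ trans (+-identityˡ _) (*-congˡ (evalPoly-window s m N p t s+m<N)) ⟩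
    t * (pow t s * evalPoly (suc m) (λ i → ι (p i)) t)
      ≈⟨ sym (*-assoc _ _ _) ⟩
    t * pow t s * evalPoly (suc m) (λ i → ι (p i)) t ∎

  -- A common zero (1 : t) of the two forms puts (1, t, t², …) in the kernel of the Sylvester matrix.
  ι-resultant≈0 : ∀ m (p q : ℕ → ℚ) t →
                  evalPoly (suc (suc m)) (λ i → ι (p i)) t ≈ 0# → evalPoly (suc (suc m)) (λ i → ι (q i)) t ≈ 0# →
                  ι (resultant (suc m) p q) ≈ 0#
  ι-resultant≈0 m p q t p[t]≈0 q[t]≈0 = trans (ι-det (suc m ℕ.+ suc m) S)
    (det-powers-in-kernel (m ℕ.+ suc m) (λ r col → ι (S r col)) t row-kernel)
    where
    S : Fin (suc m ℕ.+ suc m) → Fin (suc m ℕ.+ suc m) → ℚ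
    S r col = sylvester (suc m) p q (toℕ r) (toℕ col)
    row≈0 : ∀ r s f → (∀ col → sylvester (suc m) p q (toℕ r) col ≡ window s (suc m) f col) → s ℕ.+ suc m ℕ.< suc m ℕ.+ suc m →
            evalPoly (suc (suc m)) (λ i → ι (f i)) t ≈ 0# → ∑ (suc m ℕ.+ suc m) (λ col → ι (S r col) * pow t (toℕ col)) ≈ 0#
    row≈0 r s f row fits f[t]≈0 = begin
      ∑ (suc m ℕ.+ suc m) (λ col → ι (S r col) * pow t (toℕ col))
        ≈⟨ sym (evalPoly≈∑ (suc m ℕ.+ suc m) (λ col → ι (sylvester (suc m) p q (toℕ r) col)) t) ⟩
      evalPoly (suc m ℕ.+ suc m) (λ col → ι (sylvester (suc m) p q (toℕ r) col)) t
        ≈⟨ evalPoly-cong (suc m ℕ.+ suc m) (λ col → reflexive (P.cong ι (row col))) refl ⟩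
      evalPoly (suc m ℕ.+ suc m) (λ col → ι (window s (suc m) f col)) t
        ≈⟨ evalPoly-window s (suc m) _ f t fits ⟩
      pow t s * evalPoly (suc (suc m)) (λ i → ι (f i)) t
        ≈⟨ trans (*-congˡ f[t]≈0) (zeroʳ _) ⟩
      0# ∎
    row-kernel : ∀ r → ∑ (suc m ℕ.+ suc m) (λ col → ι (S r col) * pow t (toℕ col)) ≈ 0#
    row-kernel r with sylvester-rows (suc m) p q (toℕ r)
    ... | inj₁ (r<m , row) = row≈0 r (toℕ r) p row (ℕP.+-monoˡ-< (suc m) r<m) p[t]≈0
    ... | inj₂ (m≤r , row) = row≈0 r (toℕ r ∸ suc m) q row
                               (P.subst (ℕ._< suc m ℕ.+ suc m) (P.sym (ℕP.m∸n+n≡m m≤r)) (FinP.toℕ<n r)) q[t]≈0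

disc≡0-if-resultant≡0 : ∀ n (F : Vec ℚ (suc (suc n))) → resultant n (∂X-coef (suc n) F) (∂Y-coef (suc n) F) ≡ 0ℚ → disc (suc n) F ≡ 0ℚ
disc≡0-if-resultant≡0 n F res≡0 =
  middle≡0 (Q.sgn ((suc n ℕ.* n) ℕ./ 2)) _ (ℚ._/_ (+ 1) (suc n ℕ.^ (n ∸ 1)) {{ℕP.m^n≢0 (suc n) (n ∸ 1)}}) res≡0
  where
  middle≡0 : ∀ a b c → b ≡ 0ℚ → a ℚ.* (b ℚ.* c) ≡ 0ℚ
  middle≡0 a b c P.refl = P.trans (P.cong (a ℚ.*_) (ℚP.*-zeroˡ c)) (ℚP.*-zeroʳ a)

coef-beyond : ∀ {n} (v : Vec ℚ n) k → n ℕ.≤ k → coef v k ≡ 0ℚ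
coef-beyond []      k       _         = P.refl
coef-beyond (a ∷ v) (suc k) (s≤s n≤k) = coef-beyond v k n≤k

disc≡0-if-top-coefs≡0 : ∀ m (F : Vec ℚ (suc (suc (suc m)))) → coef F (suc m) ≡ 0ℚ → coef F (suc (suc m)) ≡ 0ℚ →
                        disc (suc (suc m)) F ≡ 0ℚ
disc≡0-if-top-coefs≡0 m F a₁≡0 a₂≡0 = disc≡0-if-resultant≡0 (suc m) F
  (Determinants.det-zero-column ℚ-algebra (suc m ℕ.+ suc m) (λ r col → sylvester (suc m) ∂X ∂Y (toℕ r) (toℕ col))
     (Fin.fromℕ (m ℕ.+ suc m)) (λ r →
    P.trans (P.cong (sylvester (suc m) ∂X ∂Y (toℕ r)) (FinP.toℕ-fromℕ (m ℕ.+ suc m)))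
            (sylvester-last-column m ∂X ∂Y
               (λ k m<k → P.trans (P.cong (ℕ→ℚ (suc (suc m) ∸ k) ℚ.*_) (coef-high k m<k)) (ℚP.*-zeroʳ (ℕ→ℚ (suc (suc m) ∸ k))))
               (λ k m<k → P.trans (P.cong (ℕ→ℚ (suc k) ℚ.*_) (coef-high (suc k) (ℕP.m≤n⇒m≤1+n m<k))) (ℚP.*-zeroʳ (ℕ→ℚ (suc k))))
               (toℕ r) (FinP.toℕ<n r))))
  where
  ∂X ∂Y : ℕ → ℚ
  ∂X = ∂X-coef (suc (suc m)) F
  ∂Y = ∂Y-coef (suc (suc m)) F
  coef-high : ∀ k → suc m ℕ.≤ k → coef F k ≡ 0ℚ
  coef-high k m<k with ℕP.m≤n⇒m<n∨m≡n m<k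
  ... | inj₂ P.refl = a₁≡0
  ... | inj₁ m+1<k with ℕP.m≤n⇒m<n∨m≡n m+1<k
  ...   | inj₂ P.refl   = a₂≡0
  ...   | inj₁ m+2<k    = coef-beyond F k m+2<k

module Discriminants {c ℓ} (A : Commutativeℚ-Algebra c ℓ) where
  open Properties A
  open Polynomials A
  open Resultants A

  -- By Euler's identity a common zero of F and ∂F/∂Y is also a zero of ∂F/∂X.
  disc≡0-if-double-root : ¬ (0# ≈ 1#) → ∀ m (F : Vec ℚ (suc (suc (suc m)))) r →
    evalPoly (suc (suc (suc m))) (λ i → ι (coef F i)) r ≈ 0# →
    deriv (suc (suc (suc m))) (λ i → ι (coef F i)) r ≈ 0# →
    disc (suc (suc m)) F ≡ 0ℚ
  disc≡0-if-double-root 0≉1 m F r F[r]≈0 F′[r]≈0 =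
    disc≡0-if-resultant≡0 (suc m) F (ι-injective 0≉1 (trans (ι-resultant≈0 m (∂X-coef d F) (∂Y-coef d F) r ∂X[r]≈0 ∂Y[r]≈0) (sym ι-0)))
    where
    d : ℕ
    d = suc (suc m)
    f : ℕ → Carrier
    f i = ι (coef F i)
    ∂X[r]≈0 : evalPoly d (λ i → ι (∂X-coef d F i)) r ≈ 0#
    ∂X[r]≈0 = begin
      evalPoly d (λ i → ι (∂X-coef d F i)) r
        ≈⟨ evalPoly-cong d (λ i → trans (ι-* (ℕ→ℚ (d ∸ i)) (coef F i)) (*-congʳ (ι-ℕ→ℚ (d ∸ i)))) refl ⟩
      evalPoly d (λ i → fromℕ (d ∸ i) * f i) r
        ≈⟨ sym (trans (+-congˡ (trans (*-congˡ F′[r]≈0) (zeroʳ r))) (+-identityʳ _)) ⟩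
      evalPoly d (λ i → fromℕ (d ∸ i) * f i) r + r * deriv (suc d) f r
        ≈⟨ sym (euler d f r) ⟩
      fromℕ d * evalPoly (suc d) f r
        ≈⟨ trans (*-congˡ F[r]≈0) (zeroʳ _) ⟩
      0# ∎
    ∂Y[r]≈0 : evalPoly d (λ i → ι (∂Y-coef d F i)) r ≈ 0#
    ∂Y[r]≈0 = begin
      evalPoly d (λ i → ι (∂Y-coef d F i)) r
        ≈⟨ evalPoly-cong d (λ i → trans (ι-* (ℕ→ℚ (suc i)) (coef F (suc i))) (*-congʳ (ι-ℕ→ℚ (suc i)))) refl ⟩
      evalPoly d (λ i → fromℕ (suc i) * f (suc i)) r
        ≈⟨ sym (deriv≈evalPoly d f r) ⟩
      deriv (suc d) f r
        ≈⟨ F′[r]≈0 ⟩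
      0# ∎

∣pow∣ : ∀ x n → ℚ.∣ Q.pow x n ∣ ≡ Q.pow ℚ.∣ x ∣ n
∣pow∣ x zero    = P.refl
∣pow∣ x (suc n) = P.trans (ℚP.∣p*q∣≡∣p∣*∣q∣ x (Q.pow x n)) (P.cong (ℚ.∣ x ∣ ℚ.*_) (∣pow∣ x n))

pow≤1 : ∀ a → 0ℚ ℚ.≤ a → a ℚ.≤ 1ℚ → ∀ n → Q.pow a n ℚ.≤ 1ℚ
pow≤1 a 0≤a a≤1 zero    = ℚP.≤-refl
pow≤1 a 0≤a a≤1 (suc n) = ℚP.≤-trans (ℚP.*-monoˡ-≤-nonNeg a (pow≤1 a 0≤a a≤1 n)) (P.subst (ℚ._≤ 1ℚ) (P.sym (ℚP.*-identityʳ a)) a≤1)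
  where instance _ = ℚ.nonNegative 0≤a

1≤pow : ∀ a → 1ℚ ℚ.≤ a → ∀ n → 1ℚ ℚ.≤ Q.pow a n
1≤pow a 1≤a zero    = ℚP.≤-refl
1≤pow a 1≤a (suc n) = ℚP.≤-trans (P.subst (ℚ._≤ a ℚ.* 1ℚ) (ℚP.*-identityʳ 1ℚ) (ℚP.*-monoʳ-≤-nonNeg 1ℚ 1≤a))
                                 (ℚP.*-monoˡ-≤-nonNeg a (1≤pow a 1≤a n))
  where instance _ = ℚ.nonNegative (ℚP.≤-trans (ℚP.<⇒≤ (ℚP.positive⁻¹ 1ℚ)) 1≤a)

nonNegative-root-of-unity : ∀ a n → 0ℚ ℚ.≤ a → Q.pow a (suc n) ≡ 1ℚ → a ≡ 1ℚ
nonNegative-root-of-unity a n 0≤a aⁿ⁺¹≡1 with ℚP.<-cmp a 1ℚ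
... | tri≈ _ a≡1 _ = a≡1
... | tri< a<1 _ _ = ⊥-elim (ℚP.<-irrefl aⁿ⁺¹≡1 (ℚP.≤-<-trans
        (ℚP.≤-trans (ℚP.*-monoˡ-≤-nonNeg a (pow≤1 a 0≤a (ℚP.<⇒≤ a<1) n)) (ℚP.≤-reflexive (ℚP.*-identityʳ a))) a<1))
  where instance _ = ℚ.nonNegative 0≤a
... | tri> _ _ a>1 = ⊥-elim (ℚP.<-irrefl (P.sym aⁿ⁺¹≡1) (ℚP.<-≤-trans a>1
        (ℚP.≤-trans (ℚP.≤-reflexive (P.sym (ℚP.*-identityʳ a))) (ℚP.*-monoˡ-≤-nonNeg a (1≤pow a (ℚP.<⇒≤ a>1) n)))))
  where instance _ = ℚ.nonNegative 0≤a

root-of-unity≡±1 : ∀ x n → Q.pow x (suc n) ≡ 1ℚ → x ≡ 1ℚ ⊎ x ≡ ℚ.- 1ℚ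
root-of-unity≡±1 x n xⁿ⁺¹≡1 =
  Sum.map (λ ∣x∣≡x → P.trans (P.sym ∣x∣≡x) ∣x∣≡1)
          (λ ∣x∣≡-x → P.trans (P.sym (neg-involutive x)) (P.cong ℚ.-_ (P.trans (P.sym ∣x∣≡-x) ∣x∣≡1)))
          (ℚP.∣p∣≡p∨∣p∣≡-p x)
  where
  ∣x∣≡1 : ℚ.∣ x ∣ ≡ 1ℚ
  ∣x∣≡1 = nonNegative-root-of-unity ℚ.∣ x ∣ n (ℚP.0≤∣p∣ x) (P.trans (P.sym (∣pow∣ x (suc n))) (P.cong ℚ.∣_∣ xⁿ⁺¹≡1))

pow-[-1] : ∀ d → (2 ∣ d × Q.pow (ℚ.- 1ℚ) d ≡ 1ℚ) ⊎ (2 ∣ suc d × Q.pow (ℚ.- 1ℚ) d ≡ ℚ.- 1ℚ)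
pow-[-1] zero = inj₁ (2 ∣0 , P.refl)
pow-[-1] (suc d) with pow-[-1] d
... | inj₁ (divides q d≡q*2 , e) = inj₂ (divides (suc q) (P.cong (λ k → suc (suc k)) d≡q*2) , P.cong (ℚ.- 1ℚ ℚ.*_) e)
... | inj₂ (2∣d+1 , e)           = inj₁ (2∣d+1 , P.cong (ℚ.- 1ℚ ℚ.*_) e)

pow-[-1]-odd : ∀ d → ¬ (2 ∣ d) → Q.pow (ℚ.- 1ℚ) d ≡ ℚ.- 1ℚ
pow-[-1]-odd d 2∤d with pow-[-1] d
... | inj₁ (2∣d , _) = ⊥-elim (2∤d 2∣d)
... | inj₂ (_ , e)   = e

pow-[-1]-even : ∀ d → 2 ∣ d → Q.pow (ℚ.- 1ℚ) d ≡ 1ℚ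
pow-[-1]-even d 2∣d with pow-[-1] d
... | inj₁ (_ , e)     = e
... | inj₂ (2∣d+1 , _) with ∣1⇒≡1 (∣m+n∣m⇒∣n (P.subst (2 ∣_) (ℕP.+-comm 1 d) 2∣d+1) 2∣d)
...   | ()

disc≡0-if-vanishing-on-ℕ : ∀ m (F : Vec ℚ (suc (suc (suc m)))) → (∀ j → Q.evalForm (suc (suc m)) F 1ℚ (ℕ→ℚ j) ≡ 0ℚ) →
                           disc (suc (suc m)) F ≡ 0ℚ
disc≡0-if-vanishing-on-ℕ m F vanish =
  disc≡0-if-top-coefs≡0 m F (coef≡0 (suc m) (s≤s (ℕP.n≤1+n (suc m)))) (coef≡0 (suc (suc m)) ℕP.≤-refl)
  where
  open Properties ℚ-algebra using (ι-ℕ→ℚ)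
  open BinaryForms ℚ-algebra using (coeff-map-ι; vanishing-on-ℕ⇒coeff≈0; ι-evalForm; evalForm-cong)
  coef≡0 : ∀ i → i ℕ.< suc (suc (suc m)) → coef F i ≡ 0ℚ
  coef≡0 i i<d+1 = P.trans (P.sym (coeff-map-ι F i)) (vanishing-on-ℕ⇒coeff≈0 (suc (suc m)) (Vec.map (λ a → a) F)
    (λ j → P.trans (evalForm-cong (suc (suc m)) (Vec.map (λ a → a) F) P.refl (P.sym (ι-ℕ→ℚ j)))
                   (P.trans (P.sym (ι-evalForm (suc (suc m)) F 1ℚ (ℕ→ℚ j))) (vanish j)))
    i i<d+1)

scalar-automorphism⇒pow≡1 : ∀ m (F : Vec ℚ (suc (suc (suc m)))) → ¬ (disc (suc (suc m)) F ≡ 0ℚ) →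
                             ∀ l → InAutℚ (suc (suc m)) F (matℚ l 0ℚ 0ℚ l) → Q.pow l (suc (suc m)) ≡ 1ℚ
scalar-automorphism⇒pow≡1 m F disc≢0 l (_ , invariant) =
  decidable-stable (Q.pow l d ℚP.≟ 1ℚ) (λ lᵈ≢1 → disc≢0 (disc≡0-if-vanishing-on-ℕ m F (F[1,j]≡0 lᵈ≢1)))
  where
  open Properties ℚ-algebra using (ι-cancelˡ; x≈y⇒x-y≈0)
  open BinaryForms ℚ-algebra using (evalForm-homogeneous; evalForm-cong)
  d : ℕ
  d = suc (suc m)
  lᵈ*F≡F : ∀ X Y → Q.pow l d ℚ.* Q.evalForm d F X Y ≡ Q.evalForm d F X Y
  lᵈ*F≡F X Y = P.trans (P.sym (evalForm-homogeneous d F l X Y))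
    (P.trans (evalForm-cong d F (P.sym (P.trans (P.cong (l ℚ.* X ℚ.+_) (ℚP.*-zeroˡ Y)) (ℚP.+-identityʳ (l ℚ.* X))))
                                (P.sym (P.trans (P.cong (ℚ._+ l ℚ.* Y) (ℚP.*-zeroˡ X)) (ℚP.+-identityˡ (l ℚ.* Y)))))
             (invariant X Y))
  [a-1]x≡ax-x : ∀ a x → (a ℚ.- 1ℚ) ℚ.* x ≡ a ℚ.* x ℚ.- x
  [a-1]x≡ax-x a x = P.trans (ℚP.*-distribʳ-+ x a (ℚ.- 1ℚ))
    (P.cong (a ℚ.* x ℚ.+_) (P.trans (P.sym (ℚP.neg-distribˡ-* 1ℚ x)) (P.cong ℚ.-_ (ℚP.*-identityˡ x))))
  F[1,j]≡0 : Q.pow l d ≢ 1ℚ → ∀ j → Q.evalForm d F 1ℚ (ℕ→ℚ j) ≡ 0ℚ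
  F[1,j]≡0 lᵈ≢1 j = ι-cancelˡ (lᵈ≢1 ∘ p-q≡0⇒p≡q (Q.pow l d) 1ℚ)
    (P.trans ([a-1]x≡ax-x (Q.pow l d) (Q.evalForm d F 1ℚ (ℕ→ℚ j))) (x≈y⇒x-y≈0 (lᵈ*F≡F 1ℚ (ℕ→ℚ j))))

Idℚ∈Aut : ∀ d F → InAutℚ d F Idℚ
Idℚ∈Aut d F = (λ ()) , λ X Y → evalForm-cong d F
  (P.trans (P.cong₂ ℚ._+_ (ℚP.*-identityˡ X) (ℚP.*-zeroˡ Y)) (ℚP.+-identityʳ X))
  (P.trans (P.cong₂ ℚ._+_ (ℚP.*-zeroˡ X) (ℚP.*-identityˡ Y)) (ℚP.+-identityˡ Y))
  where open BinaryForms ℚ-algebra using (evalForm-cong)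

-Idℚ∈Aut : ∀ d F → 2 ∣ d → InAutℚ d F -Idℚ
-Idℚ∈Aut d F 2∣d = (λ ()) , λ X Y → begin
  Q.evalForm d F (-1ℚ ℚ.* X ℚ.+ 0ℚ ℚ.* Y) (0ℚ ℚ.* X ℚ.+ -1ℚ ℚ.* Y)
    ≡⟨ evalForm-cong d F (P.trans (P.cong (-1ℚ ℚ.* X ℚ.+_) (ℚP.*-zeroˡ Y)) (ℚP.+-identityʳ (-1ℚ ℚ.* X)))
                         (P.trans (P.cong (ℚ._+ -1ℚ ℚ.* Y) (ℚP.*-zeroˡ X)) (ℚP.+-identityˡ (-1ℚ ℚ.* Y))) ⟩
  Q.evalForm d F (-1ℚ ℚ.* X) (-1ℚ ℚ.* Y)
    ≡⟨ evalForm-homogeneous d F -1ℚ X Y ⟩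
  Q.pow -1ℚ d ℚ.* Q.evalForm d F X Y
    ≡⟨ P.cong (ℚ._* Q.evalForm d F X Y) (pow-[-1]-even d 2∣d) ⟩
  1ℚ ℚ.* Q.evalForm d F X Y
    ≡⟨ ℚP.*-identityˡ _ ⟩
  Q.evalForm d F X Y ∎
  where
  open BinaryForms ℚ-algebra using (evalForm-cong; evalForm-homogeneous)
  open P.≡-Reasoning
  -1ℚ : ℚ
  -1ℚ = ℚ.- 1ℚ

closedField→algebra : ∀ {c ℓ} → ClosedFieldOverℚ c ℓ → Commutativeℚ-Algebra c ℓ
closedField→algebra K = record
  { commutativeRing = K-ring ; ι = ι ; ι-0 = ι-0 ; ι-1 = ι-1 ; ι-+ = ι-+ ; ι-* = ι-* }
  where open ClosedFieldOverℚ K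

module ClosedFields {c ℓ} (K : ClosedFieldOverℚ c ℓ) where
  open ClosedFieldOverℚ K using (0≉1; inverse; closed)
  open Properties (closedField→algebra K)
  open Polynomials (closedField→algebra K)

  *-cancelˡ : ∀ {a x} → ¬ (a ≈ 0#) → a * x ≈ 0# → x ≈ 0#
  *-cancelˡ {a} {x} a≉0 ax≈0 with inverse a a≉0
  ... | b , ab≈1 = begin
    x           ≈⟨ sym (*-identityˡ x) ⟩
    1# * x      ≈⟨ *-congʳ (sym ab≈1) ⟩
    a * b * x   ≈⟨ solve 3 (λ a b x → a :* b :* x := b :* (a :* x)) refl a b x ⟩
    b * (a * x) ≈⟨ *-congˡ ax≈0 ⟩
    b * 0#      ≈⟨ zeroʳ b ⟩
    0#          ∎

  -‿cancelˡ : ∀ {x y z} → ¬ (x ≈ y) → (x - y) * z ≈ 0# → z ≈ 0#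
  -‿cancelˡ x≉y = *-cancelˡ (x≉y ∘ x-y≈0⇒x≈y _ _)

  root-exists : ∀ n p → ¬ (p (suc n) ≈ 0#) → Σ Carrier λ r → evalPoly (suc (suc n)) p r ≈ 0#
  root-exists n p lead≉0 with inverse (p (suc n)) lead≉0
  ... | b , lead*b≈1 with closed n (λ i → b * p (toℕ i))
  ...   | r , monic[r]≈0 = r , (begin
    evalPoly (suc (suc n)) p r
      ≈⟨ evalPoly-split-last (suc n) p r ⟩
    evalPoly (suc n) p r + p (suc n) * pow r (suc n)
      ≈⟨ solve 4 (λ S a b R → S :+ a :* R := a :* (R :+ b :* S) :+ (con 1ℚ :- a :* b) :* S) refl
           (evalPoly (suc n) p r) (p (suc n)) b (pow r (suc n)) ⟩
    p (suc n) * (pow r (suc n) + b * evalPoly (suc n) p r) + (ι 1ℚ - p (suc n) * b) * evalPoly (suc n) p r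
      ≈⟨ +-cong (*-congˡ (trans (+-congˡ lower-terms) monic[r]≈0))
                (trans (*-congʳ (trans (+-cong ι-1 (-‿cong lead*b≈1)) (-‿inverseʳ 1#))) (zeroˡ _)) ⟩
    p (suc n) * 0# + 0#
      ≈⟨ trans (+-identityʳ _) (zeroʳ _) ⟩
    0# ∎)
    where
    lower-terms : b * evalPoly (suc n) p r ≈ ∑ (suc n) (λ i → b * p (toℕ i) * pow r (toℕ i))
    lower-terms = trans (*-congˡ (evalPoly≈∑ (suc n) p r))
      (trans (sym (∑-distribˡ-* (suc n) b (λ i → p (toℕ i) * pow r (toℕ i))))
             (∑-cong (suc n) (λ i → sym (*-assoc b (p (toℕ i)) (pow r (toℕ i))))))

  deriv≈0-at-second-root : ∀ n p r₁ r₂ → ¬ (r₁ ≈ r₂) → evalPoly (suc (suc n)) p r₁ ≈ 0# → evalPoly (suc (suc n)) p r₂ ≈ 0# →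
                           evalPoly n (quot (suc n) r₂ (quot (suc (suc n)) r₁ p)) r₂ ≈ 0# → deriv (suc (suc n)) p r₂ ≈ 0#
  deriv≈0-at-second-root n p r₁ r₂ r₁≉r₂ p[r₁]≈0 p[r₂]≈0 h[r₂]≈0 = begin
    deriv (suc (suc n)) p r₂
      ≈⟨ sym (evalPoly-quot-at-r (suc n) p r₂) ⟩
    evalPoly (suc n) q r₂
      ≈⟨ evalPoly-factor n q r₁ r₂ ⟩
    evalPoly (suc n) q r₁ + (r₂ - r₁) * evalPoly n (quot (suc n) r₁ q) r₂
      ≈⟨ +-cong q[r₁]≈0 (*-congˡ (trans (evalPoly-quot-comm n p r₂ r₁ r₂) h[r₂]≈0)) ⟩
    0# + (r₂ - r₁) * 0#
      ≈⟨ trans (+-identityˡ _) (zeroʳ _) ⟩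
    0# ∎
    where
    q : ℕ → Carrier
    q = quot (suc (suc n)) r₂ p
    q[r₁]≈0 : evalPoly (suc n) q r₁ ≈ 0#
    q[r₁]≈0 = -‿cancelˡ r₁≉r₂ (factor-at-roots (suc n) p r₂ r₁ p[r₂]≈0 p[r₁]≈0)

  -- Split off roots r₁, r₂, r₃ by synthetic division; any coincidence among them is a double root.
  ¬¬-three-distinct-roots : ∀ n p → ¬ (p (suc (suc (suc n))) ≈ 0#) → ¬ HasDoubleRoot (suc (suc (suc (suc n)))) p →
                            ¬ ¬ ThreeDistinct (λ r → evalPoly (suc (suc (suc (suc n)))) p r ≈ 0#)
  ¬¬-three-distinct-roots n p lead≉0 simple no-three =
    ¬¬-excluded-middle λ r₁≟r₂ → ¬¬-excluded-middle λ r₁≟r₃ → ¬¬-excluded-middle λ r₂≟r₃ → conclude r₁≟r₂ r₁≟r₃ r₂≟r₃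
    where
    N : ℕ
    N = suc (suc (suc n))
    r₁ : Carrier
    r₁ = proj₁ (root-exists (suc (suc n)) p lead≉0)
    p[r₁]≈0 : evalPoly (suc N) p r₁ ≈ 0#
    p[r₁]≈0 = proj₂ (root-exists (suc (suc n)) p lead≉0)
    h₁ : ℕ → Carrier
    h₁ = quot (suc N) r₁ p
    h₁-lead≉0 : ¬ (h₁ (suc (suc n)) ≈ 0#)
    h₁-lead≉0 = lead≉0 ∘ trans (sym (quot-leading (suc (suc n)) r₁ p))
    r₂ : Carrier
    r₂ = proj₁ (root-exists (suc n) h₁ h₁-lead≉0)
    h₁[r₂]≈0 : evalPoly N h₁ r₂ ≈ 0#
    h₁[r₂]≈0 = proj₂ (root-exists (suc n) h₁ h₁-lead≉0)
    h₂ : ℕ → Carrier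
    h₂ = quot N r₂ h₁
    h₂-lead≉0 : ¬ (h₂ (suc n) ≈ 0#)
    h₂-lead≉0 = h₁-lead≉0 ∘ trans (sym (quot-leading (suc n) r₂ h₁))
    r₃ : Carrier
    r₃ = proj₁ (root-exists n h₂ h₂-lead≉0)
    h₂[r₃]≈0 : evalPoly (suc (suc n)) h₂ r₃ ≈ 0#
    h₂[r₃]≈0 = proj₂ (root-exists n h₂ h₂-lead≉0)
    h₁[r₃]≈0 : evalPoly N h₁ r₃ ≈ 0#
    h₁[r₃]≈0 = root-via-quot (suc (suc n)) h₁ r₂ r₃ h₁[r₂]≈0 h₂[r₃]≈0
    p[r₂]≈0 : evalPoly (suc N) p r₂ ≈ 0#
    p[r₂]≈0 = root-via-quot N p r₁ r₂ p[r₁]≈0 h₁[r₂]≈0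
    p[r₃]≈0 : evalPoly (suc N) p r₃ ≈ 0#
    p[r₃]≈0 = root-via-quot N p r₁ r₃ p[r₁]≈0 h₁[r₃]≈0
    conclude : Dec (r₁ ≈ r₂) → Dec (r₁ ≈ r₃) → Dec (r₂ ≈ r₃) → ⊥
    conclude (yes r₁≈r₂) _ _ =
      simple (double-root-if-quot-root N p r₁ p[r₁]≈0 (trans (evalPoly-congʳ N h₁ r₁≈r₂) h₁[r₂]≈0))
    conclude (no _) (yes r₁≈r₃) _ =
      simple (double-root-if-quot-root N p r₁ p[r₁]≈0 (trans (evalPoly-congʳ N h₁ r₁≈r₃) h₁[r₃]≈0))
    conclude (no r₁≉r₂) (no _) (yes r₂≈r₃) =
      simple (r₂ , p[r₂]≈0 , deriv≈0-at-second-root (suc (suc n)) p r₁ r₂ r₁≉r₂ p[r₁]≈0 p[r₂]≈0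
                                (trans (evalPoly-congʳ (suc (suc n)) h₂ r₂≈r₃) h₂[r₃]≈0))
    conclude (no r₁≉r₂) (no r₁≉r₃) (no r₂≉r₃) = no-three (record
      { r₁ = r₁ ; r₂ = r₂ ; r₃ = r₃ ; P₁ = p[r₁]≈0 ; P₂ = p[r₂]≈0 ; P₃ = p[r₃]≈0
      ; r₁≉r₂ = r₁≉r₂ ; r₁≉r₃ = r₁≉r₃ ; r₂≉r₃ = r₂≉r₃ })

  quadratic-vanishing-at-three-points : ∀ a b c → ThreeDistinct (λ r → a * (r * r) + b * r + c ≈ 0#) → a ≈ 0# × b ≈ 0# × c ≈ 0#
  quadratic-vanishing-at-three-points a b c T = a≈0 , b≈0 , c≈0
    where
    open ThreeDistinct T
    Q : Carrier → Carrier
    Q x = a * (x * x) + b * x + c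
    slope : Carrier → Carrier → Carrier
    slope x y = a * (x + y) + b
    slope≈0 : ∀ {x y} → ¬ (x ≈ y) → Q x ≈ 0# → Q y ≈ 0# → slope x y ≈ 0#
    slope≈0 {x} {y} x≉y Qx≈0 Qy≈0 = -‿cancelˡ x≉y (begin
      (x - y) * slope x y
        ≈⟨ solve 5 (λ a b c x y → (x :- y) :* (a :* (x :+ y) :+ b) := (a :* (x :* x) :+ b :* x :+ c) :- (a :* (y :* y) :+ b :* y :+ c)) refl a b c x y ⟩
      Q x - Q y
        ≈⟨ x≈y⇒x-y≈0 (trans Qx≈0 (sym Qy≈0)) ⟩
      0# ∎)
    s₂₁ : slope r₂ r₁ ≈ 0#
    s₂₁ = slope≈0 (r₁≉r₂ ∘ sym) P₂ P₁
    s₃₁ : slope r₃ r₁ ≈ 0#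
    s₃₁ = slope≈0 (r₁≉r₃ ∘ sym) P₃ P₁
    a≈0 : a ≈ 0#
    a≈0 = -‿cancelˡ (r₂≉r₃ ∘ sym) (begin
      (r₃ - r₂) * a
        ≈⟨ solve 5 (λ a b x y z → (x :- y) :* a := (a :* (x :+ z) :+ b) :- (a :* (y :+ z) :+ b)) refl a b r₃ r₂ r₁ ⟩
      slope r₃ r₁ - slope r₂ r₁
        ≈⟨ x≈y⇒x-y≈0 (trans s₃₁ (sym s₂₁)) ⟩
      0# ∎)
    b≈0 : b ≈ 0#
    b≈0 = trans (sym (trans (+-congʳ (trans (*-congʳ a≈0) (zeroˡ _))) (+-identityˡ b))) s₂₁
    c≈0 : c ≈ 0#
    c≈0 = trans (sym (trans (+-congʳ (+-cong (trans (*-congʳ a≈0) (zeroˡ _)) (trans (*-congʳ b≈0) (zeroˡ _))))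
                            (trans (+-congʳ (+-identityʳ 0#)) (+-identityˡ c)))) P₁

module Lifting {c ℓ} (K : ClosedFieldOverℚ c ℓ) (d : ℕ) (F : Vec ℚ (suc d)) where
  open ClosedFieldOverℚ K using (0≉1)
  open Properties (closedField→algebra K)
  open Polynomials (closedField→algebra K)
  open BinaryForms (closedField→algebra K)
  open ClosedFields K
  open Zeros K d F using (NonZeroPt; _∼_; InZ; hom; PermutesZ; AutZTrivial)

  F̂ : Vec Carrier (suc d)
  F̂ = Vec.map ι F

  f : ℕ → Carrier
  f i = ι (coef F i)

  F̂[1,t]≈f[t] : ∀ t → evalForm d F̂ 1# t ≈ evalPoly (suc d) f t
  F̂[1,t]≈f[t] t = trans (evalForm-at-1 d F̂ t) (evalPoly-cong (suc d) (coeff-map-ι F) refl)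

  lift : Mat2ℚ → Mat2
  lift (matℚ u1 u2 u3 u4) = mat (ι u1) (ι u2) (ι u3) (ι u4)

  ι-compose : ∀ γ X Y → ι (Q.compose d F γ X Y) ≈ compose d F̂ (lift γ) (ι X) (ι Y)
  ι-compose (matℚ u1 u2 u3 u4) X Y = trans (ι-evalForm d F _ _) (evalForm-cong d F̂ (ι-linear u1 u2) (ι-linear u3 u4))
    where
    ι-linear : ∀ a b → ι (a ℚ.* X ℚ.+ b ℚ.* Y) ≈ ι a * ι X + ι b * ι Y
    ι-linear a b = trans (ι-+ _ _) (+-cong (ι-* a X) (ι-* b Y))

  ι-det2 : ∀ γ → ι (det2ℚ γ) ≈ det2 (lift γ)
  ι-det2 (matℚ u1 u2 u3 u4) = trans (ι-+ _ _) (+-cong (ι-* u1 u4) (trans (ι-neg _) (-‿cong (ι-* u2 u3))))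

  invariance-lifts : ∀ γ → InAutℚ d F γ → ∀ X Y → compose d F̂ (lift γ) X Y ≈ evalForm d F̂ X Y
  invariance-lifts γ (_ , invariant) X Y = begin
    compose d F̂ (lift γ) X Y                    ≈⟨ sym (evalForm-composeCoeffs d F̂ (lift γ) X Y) ⟩
    evalForm d (composeCoeffs d F̂ (lift γ)) X Y ≈⟨ agreeing-on-ℕ⇒equal-forms d (composeCoeffs d F̂ (lift γ)) F̂ agree X Y ⟩
    evalForm d F̂ X Y                            ∎
    where
    agree : ∀ j → evalForm d (composeCoeffs d F̂ (lift γ)) 1# (fromℕ j) ≈ evalForm d F̂ 1# (fromℕ j)
    agree j = begin
      evalForm d (composeCoeffs d F̂ (lift γ)) 1# (fromℕ j) ≈⟨ evalForm-composeCoeffs d F̂ (lift γ) 1# (fromℕ j) ⟩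
      compose d F̂ (lift γ) 1# (fromℕ j)         ≈⟨ compose-cong d F̂ (lift γ) (sym ι-1) (sym (ι-ℕ→ℚ j)) ⟩
      compose d F̂ (lift γ) (ι 1ℚ) (ι (ℕ→ℚ j))   ≈⟨ sym (ι-compose γ 1ℚ (ℕ→ℚ j)) ⟩
      ι (Q.compose d F γ 1ℚ (ℕ→ℚ j))            ≈⟨ reflexive (P.cong ι (invariant 1ℚ (ℕ→ℚ j))) ⟩
      ι (Q.evalForm d F 1ℚ (ℕ→ℚ j))             ≈⟨ ι-evalForm d F 1ℚ (ℕ→ℚ j) ⟩
      evalForm d F̂ (ι 1ℚ) (ι (ℕ→ℚ j))          ≈⟨ evalForm-cong d F̂ ι-1 (ι-ℕ→ℚ j) ⟩
      evalForm d F̂ 1# (fromℕ j)                 ∎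

  adjugate : Mat2 → Mat2
  adjugate (mat a b c e) = mat e (- b) (- c) a

  adjugate-hom : ∀ γ x t → proj₁ (hom (adjugate γ) (hom γ (x , t))) ≈ det2 γ * x × proj₂ (hom (adjugate γ) (hom γ (x , t))) ≈ det2 γ * t
  adjugate-hom (mat a b c e) x t =
    solve 6 (λ a b c e x t → e :* (a :* x :+ b :* t) :+ (:- b) :* (c :* x :+ e :* t) := (a :* e :- b :* c) :* x) refl a b c e x t ,
    solve 6 (λ a b c e x t → (:- c) :* (a :* x :+ b :* t) :+ a :* (c :* x :+ e :* t) := (a :* e :- b :* c) :* t) refl a b c e x t

  hom-adjugate : ∀ γ x t → proj₁ (hom γ (hom (adjugate γ) (x , t))) ≈ det2 γ * x × proj₂ (hom γ (hom (adjugate γ) (x , t))) ≈ det2 γ * t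
  hom-adjugate (mat a b c e) x t =
    solve 6 (λ a b c e x t → a :* (e :* x :+ (:- b) :* t) :+ b :* ((:- c) :* x :+ a :* t) := (a :* e :- b :* c) :* x) refl a b c e x t ,
    solve 6 (λ a b c e x t → c :* (e :* x :+ (:- b) :* t) :+ e :* ((:- c) :* x :+ a :* t) := (a :* e :- b :* c) :* t) refl a b c e x t

  hom-zero : ∀ γ {x t} → x ≈ 0# → t ≈ 0# → proj₁ (hom γ (x , t)) ≈ 0# × proj₂ (hom γ (x , t)) ≈ 0#
  hom-zero (mat a b c e) {x} {t} x≈0 t≈0 = linear≈0 a b , linear≈0 c e
    where
    linear≈0 : ∀ u v → u * x + v * t ≈ 0#
    linear≈0 u v = trans (+-cong (trans (*-congˡ x≈0) (zeroʳ u)) (trans (*-congˡ t≈0) (zeroʳ v))) (+-identityʳ 0#)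

  hom-nonzero : ∀ γ {x t} → ¬ (det2 γ ≈ 0#) → NonZeroPt x t → NonZeroPt (proj₁ (hom γ (x , t))) (proj₂ (hom γ (x , t)))
  hom-nonzero γ {x} {t} δ≉0 nz (x′≈0 , t′≈0) = nz
    ( *-cancelˡ δ≉0 (trans (sym (proj₁ (adjugate-hom γ x t))) (proj₁ back≈0))
    , *-cancelˡ δ≉0 (trans (sym (proj₂ (adjugate-hom γ x t))) (proj₂ back≈0)) )
    where
    back≈0 : proj₁ (hom (adjugate γ) (hom γ (x , t))) ≈ 0# × proj₂ (hom (adjugate γ) (hom γ (x , t))) ≈ 0#
    back≈0 = hom-zero (adjugate γ) x′≈0 t′≈0

  lift-det≉0 : ∀ γ → InAutℚ d F γ → ¬ (det2 (lift γ) ≈ 0#)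
  lift-det≉0 γ (det≢0 , _) δ≈0 = det≢0 (ι-injective 0≉1 (trans (trans (ι-det2 γ) δ≈0) (sym ι-0)))

  permutes-zeros : ∀ γ → InAutℚ d F γ → PermutesZ (lift γ)
  permutes-zeros γ aut = forward , backward
    where
    γ̂ : Mat2
    γ̂ = lift γ
    δ≉0 : ¬ (det2 γ̂ ≈ 0#)
    δ≉0 = lift-det≉0 γ aut
    forward : ∀ p → InZ p → InZ (hom γ̂ p)
    forward (x , t) (nz , F̂[p]≈0) = hom-nonzero γ̂ δ≉0 nz , trans (invariance-lifts γ aut x t) F̂[p]≈0
    backward : ∀ q → InZ q → ∃ λ p → InZ p × (hom γ̂ p ∼ q)
    backward (x , t) (nz , F̂[q]≈0) = p , (nz-p , F̂[p]≈0) , γ̂p∼q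
      where
      p : Carrier × Carrier
      p = hom (adjugate γ̂) (x , t)
      γ̂p≈δq : proj₁ (hom γ̂ p) ≈ det2 γ̂ * x × proj₂ (hom γ̂ p) ≈ det2 γ̂ * t
      γ̂p≈δq = hom-adjugate γ̂ x t
      nz-p : NonZeroPt (proj₁ p) (proj₂ p)
      nz-p (p₁≈0 , p₂≈0) = nz
        ( *-cancelˡ δ≉0 (trans (sym (proj₁ γ̂p≈δq)) (proj₁ (hom-zero γ̂ p₁≈0 p₂≈0)))
        , *-cancelˡ δ≉0 (trans (sym (proj₂ γ̂p≈δq)) (proj₂ (hom-zero γ̂ p₁≈0 p₂≈0))) )
      F̂[p]≈0 : evalForm d F̂ (proj₁ p) (proj₂ p) ≈ 0#
      F̂[p]≈0 = begin
        evalForm d F̂ (proj₁ p) (proj₂ p)                   ≈⟨ sym (invariance-lifts γ aut (proj₁ p) (proj₂ p)) ⟩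
        evalForm d F̂ (proj₁ (hom γ̂ p)) (proj₂ (hom γ̂ p))   ≈⟨ evalForm-cong d F̂ (proj₁ γ̂p≈δq) (proj₂ γ̂p≈δq) ⟩
        evalForm d F̂ (det2 γ̂ * x) (det2 γ̂ * t)             ≈⟨ evalForm-homogeneous d F̂ (det2 γ̂) x t ⟩
        pow (det2 γ̂) d * evalForm d F̂ x t                  ≈⟨ trans (*-congˡ F̂[q]≈0) (zeroʳ _) ⟩
        0#                                                 ∎
      γ̂p∼q : hom γ̂ p ∼ (x , t)
      γ̂p∼q = trans (*-congʳ (proj₁ γ̂p≈δq))
               (trans (solve 3 (λ δ x t → δ :* x :* t := x :* (δ :* t)) refl (det2 γ̂) x t) (*-congˡ (sym (proj₂ γ̂p≈δq))))

  zeros-satisfy-fixed-point-quadratic : AutZTrivial → ∀ u1 u2 u3 u4 → InAutℚ d F (matℚ u1 u2 u3 u4) →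
    ∀ r → evalPoly (suc d) f r ≈ 0# → ι u2 * (r * r) + (ι u1 - ι u4) * r + (- ι u3) ≈ 0#
  zeros-satisfy-fixed-point-quadratic fixes-zeros u1 u2 u3 u4 aut r f[r]≈0 = begin
    ι u2 * (r * r) + (ι u1 - ι u4) * r + (- ι u3)
      ≈⟨ solve 5 (λ a b c e r → b :* (r :* r) :+ (a :- e) :* r :+ (:- c) := (a :+ b :* r) :* r :- (c :+ e :* r)) refl
           (ι u1) (ι u2) (ι u3) (ι u4) r ⟩
    (ι u1 + ι u2 * r) * r - (ι u3 + ι u4 * r)
      ≈⟨ x≈y⇒x-y≈0 (trans (*-congʳ (+-congʳ (sym (*-identityʳ (ι u1)))))
                    (trans (fixes-zeros γ̂ (lift-det≉0 γ aut) (permutes-zeros γ aut) (1# , r) (1≉0 , 1,r∈Z))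
                           (trans (*-identityˡ _) (+-congʳ (*-identityʳ (ι u3)))))) ⟩
    0# ∎
    where
    γ : Mat2ℚ
    γ = matℚ u1 u2 u3 u4
    γ̂ : Mat2
    γ̂ = lift γ
    1≉0 : NonZeroPt 1# r
    1≉0 (1≈0 , _) = 0≉1 (sym 1≈0)
    1,r∈Z : evalForm d F̂ 1# r ≈ 0#
    1,r∈Z = trans (F̂[1,t]≈f[t] r) f[r]≈0

module SeparableForms {c ℓ} (K : ClosedFieldOverℚ c ℓ) where
  open ClosedFieldOverℚ K using (0≉1)
  open Properties (closedField→algebra K)
  open Polynomials (closedField→algebra K)
  open Discriminants (closedField→algebra K)
  open ClosedFields K

  -- If the two top coefficients of F vanish then so does disc F, so F(1, t) has degree d or d - 1.
  ¬¬-three-distinct-zeros : ∀ e (F : Vec ℚ (suc (suc (suc (suc (suc e)))))) → ¬ (disc (suc (suc (suc (suc e)))) F ≡ 0ℚ) →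
    ¬ ¬ ThreeDistinct (λ r → evalPoly (suc (suc (suc (suc (suc e))))) (λ i → ι (coef F i)) r ≈ 0#)
  ¬¬-three-distinct-zeros e F disc≢0 = by-cases (coef F d ℚP.≟ 0ℚ) (coef F (suc n) ℚP.≟ 0ℚ)
    where
    n d : ℕ
    n = suc (suc e)
    d = suc (suc n)
    f : ℕ → Carrier
    f i = ι (coef F i)
    ι≉0 : ∀ {a} → a ≢ 0ℚ → ¬ (ι a ≈ 0#)
    ι≉0 a≢0 ιa≈0 = a≢0 (ι-injective 0≉1 (trans ιa≈0 (sym ι-0)))
    separable : ¬ HasDoubleRoot (suc d) f
    separable (r , f[r]≈0 , f′[r]≈0) = disc≢0 (disc≡0-if-double-root 0≉1 n F r f[r]≈0 f′[r]≈0)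
    by-cases : Dec (coef F d ≡ 0ℚ) → Dec (coef F (suc n) ≡ 0ℚ) →
               ¬ ¬ ThreeDistinct (λ r → evalPoly (suc d) f r ≈ 0#)
    by-cases (no aₙ≢0) _ = ¬¬-three-distinct-roots (suc e) f (ι≉0 aₙ≢0) separable
    by-cases (yes aₙ≡0) (yes aₙ₋₁≡0) = ⊥-elim (disc≢0 (disc≡0-if-top-coefs≡0 n F aₙ₋₁≡0 aₙ≡0))
    by-cases (yes aₙ≡0) (no aₙ₋₁≢0) =
      ¬¬-map (ThreeDistinct-map (λ r f[r]≈0 → trans (evalPoly-trim d f r fₙ≈0) f[r]≈0))
             (¬¬-three-distinct-roots e f (ι≉0 aₙ₋₁≢0) separable′)
      where
      fₙ≈0 : f d ≈ 0#
      fₙ≈0 = trans (reflexive (P.cong ι aₙ≡0)) ι-0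
      separable′ : ¬ HasDoubleRoot d f
      separable′ (r , f[r]≈0 , f′[r]≈0) =
        separable (r , trans (evalPoly-trim d f r fₙ≈0) f[r]≈0 , trans (deriv-trim d f r fₙ≈0) f′[r]≈0)

module Classification {c ℓ} (K : ClosedFieldOverℚ c ℓ) (e : ℕ) (F : Vec ℚ (suc (suc (suc (suc (suc e)))))) where
  open ClosedFieldOverℚ K using (0≉1)
  open Properties (closedField→algebra K)
  open Polynomials (closedField→algebra K) using (ThreeDistinct-map)
  open ClosedFields K using (quadratic-vanishing-at-three-points)
  open SeparableForms K using (¬¬-three-distinct-zeros)

  d : ℕ
  d = suc (suc (suc (suc e)))

  open Lifting K d F using (zeros-satisfy-fixed-point-quadratic)
  open Zeros K d F using (AutZTrivial)

  automorphism-is-scalar : ¬ (disc d F ≡ 0ℚ) → AutZTrivial → ∀ u1 u2 u3 u4 → InAutℚ d F (matℚ u1 u2 u3 u4) →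
                           u2 ≡ 0ℚ × u3 ≡ 0ℚ × u1 ≡ u4
  automorphism-is-scalar disc≢0 fixes-zeros u1 u2 u3 u4 aut =
    decidable-stable ((u2 ℚP.≟ 0ℚ) ×-dec (u3 ℚP.≟ 0ℚ) ×-dec (u1 ℚP.≟ u4)) λ not-scalar →
      ¬¬-three-distinct-zeros e F disc≢0 λ zeros →
        not-scalar (scalar (quadratic-vanishing-at-three-points _ _ _
          (ThreeDistinct-map (zeros-satisfy-fixed-point-quadratic fixes-zeros u1 u2 u3 u4 aut) zeros)))
    where
    ι≈0 : ∀ {a} → ι a ≈ 0# → a ≡ 0ℚ
    ι≈0 ιa≈0 = ι-injective 0≉1 (trans ιa≈0 (sym ι-0))
    scalar : ι u2 ≈ 0# × ι u1 - ι u4 ≈ 0# × - ι u3 ≈ 0# → u2 ≡ 0ℚ × u3 ≡ 0ℚ × u1 ≡ u4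
    scalar (a≈0 , b≈0 , c≈0) =
      ι≈0 a≈0 , ι≈0 (sym (x-y≈0⇒x≈y 0# _ (trans (+-identityˡ _) c≈0))) , ι-injective 0≉1 (x-y≈0⇒x≈y _ _ b≈0)

  automorphism-cases : ¬ (disc d F ≡ 0ℚ) → AutZTrivial → ∀ γ → InAutℚ d F γ →
                  γ ≡ Idℚ ⊎ (γ ≡ -Idℚ × Q.pow (ℚ.- 1ℚ) d ≡ 1ℚ)
  automorphism-cases disc≢0 fixes-zeros γ@(matℚ u1 u2 u3 u4) aut =
    Sum.map (P.trans γ≡u1·Id ∘ P.cong scalarℚ) (λ u1≡-1 → P.trans γ≡u1·Id (P.cong scalarℚ u1≡-1) , P.subst (λ a → Q.pow a d ≡ 1ℚ) u1≡-1 u1ᵈ≡1)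
      (root-of-unity≡±1 u1 (suc (suc (suc e))) u1ᵈ≡1)
    where
    scalarℚ : ℚ → Mat2ℚ
    scalarℚ a = matℚ a 0ℚ 0ℚ a
    scalar⇒γ≡u1·Id : u2 ≡ 0ℚ × u3 ≡ 0ℚ × u1 ≡ u4 → γ ≡ scalarℚ u1
    scalar⇒γ≡u1·Id (u2≡0 , u3≡0 , u1≡u4) =
      P.trans (P.cong₂ (λ b c → matℚ u1 b c u4) u2≡0 u3≡0) (P.cong (matℚ u1 0ℚ 0ℚ) (P.sym u1≡u4))
    γ≡u1·Id : γ ≡ scalarℚ u1
    γ≡u1·Id = scalar⇒γ≡u1·Id (automorphism-is-scalar disc≢0 fixes-zeros u1 u2 u3 u4 aut)
    u1ᵈ≡1 : Q.pow u1 d ≡ 1ℚ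
    u1ᵈ≡1 = scalar-automorphism⇒pow≡1 (suc (suc e)) F disc≢0 u1 (P.subst (InAutℚ d F) γ≡u1·Id aut)

  private
    -1≢1 : ℚ.- 1ℚ ≢ 1ℚ
    -1≢1 ()

  Id∈Aut : ∀ {γ} → γ ≡ Idℚ → InAutℚ d F γ
  Id∈Aut γ≡Id = P.subst (InAutℚ d F) (P.sym γ≡Id) (Idℚ∈Aut d F)

  -Id∈Aut : 2 ∣ d → ∀ {γ} → γ ≡ -Idℚ → InAutℚ d F γ
  -Id∈Aut 2∣d γ≡-Id = P.subst (InAutℚ d F) (P.sym γ≡-Id) (-Idℚ∈Aut d F 2∣d)

  automorphism≡Id-if-odd : ¬ (disc d F ≡ 0ℚ) → AutZTrivial → ¬ (2 ∣ d) → ∀ γ → InAutℚ d F γ → γ ≡ Idℚ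
  automorphism≡Id-if-odd disc≢0 fixes-zeros 2∤d γ =
    Sum.[ (λ γ≡Id → γ≡Id) , (λ (_ , [-1]ᵈ≡1) → ⊥-elim (-1≢1 (P.trans (P.sym (pow-[-1]-odd d 2∤d)) [-1]ᵈ≡1))) ]
    ∘ automorphism-cases disc≢0 fixes-zeros γ

  automorphism≡±Id : ¬ (disc d F ≡ 0ℚ) → AutZTrivial → ∀ γ → InAutℚ d F γ → γ ≡ Idℚ ⊎ γ ≡ -Idℚ
  automorphism≡±Id disc≢0 fixes-zeros γ = Sum.map₂ proj₁ ∘ automorphism-cases disc≢0 fixes-zeros γ

lemma4p3 : ∀ {c ℓ} (K : ClosedFieldOverℚ c ℓ) (d : ℕ) → 4 ℕ.≤ d →
           (F : Vec ℚ (suc d)) → ¬ (disc d F ≡ 0ℚ) →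
           Zeros.AutZTrivial K d F →
           (¬ (2 ∣ d) → ∀ γ → InAutℚ d F γ ⇔ (γ ≡ Idℚ)) ×
           (2 ∣ d → ∀ γ → InAutℚ d F γ ⇔ ((γ ≡ Idℚ) ⊎ (γ ≡ -Idℚ)))
lemma4p3 K (suc (suc (suc (suc e)))) (s≤s (s≤s (s≤s (s≤s z≤n)))) F disc≢0 fixes-zeros =
  (λ 2∤d γ → mk⇔ (automorphism≡Id-if-odd disc≢0 fixes-zeros 2∤d γ) Id∈Aut) ,
  (λ 2∣d γ → mk⇔ (automorphism≡±Id disc≢0 fixes-zeros γ) Sum.[ Id∈Aut , -Id∈Aut 2∣d ])
  where open Classification K e F
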